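{- If $N$ is an arboreal network, then its shared ancestry graph $\mathcal A(N)$ is Ptolemaic.
   Context: In a digraph, a leaf is a vertex of indegree 1 and outdegree 0, a root is a vertex of indegree 0. A network on a finite set $X$ ($|X|\ge2$) is a simple acyclic digraph $N$ whose underlying undirected graph is connected, whose set of leaves is $X$, in which every vertex of indegree 0 has outdegree at least 2, every vertex of outdegree 0 has indegree 1, and no vertex has both indegree and outdegree equal to 1. $N$ is arboreal if its underlying undirected graph is a tree. $\mathcal A(N)$ is the graph with vertex set $X$ in which distinct $x,y$ are adjacent iff some vertex of $N$ has directed paths (possibly of length 0) to both. A graph is Ptolemaic if its shortest-path distance $d^*$ satisfies $d^*(x,y)d^*(z,u)+d^*(x,u)d^*(y,z)\ge d^*(x,z)d^*(y,u)$ for all vertices $x,y,z,u$. -}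

module Defs where

open import Data.Nat using (ℕ; zero; suc; _+_; _*_; _≤_)
open import Data.Fin using (Fin; zero; suc)
open import Data.Bool using (Bool; true; false; if_then_else_)
open import Data.List using (List; []; _∷_; _∷ʳ_; length)
open import Data.List.Relation.Unary.Linked using (Linked)
open import Data.List.Relation.Unary.Unique.Propositional using (Unique)
open import Data.Product using (Σ; _×_; ∃; ∃-syntax; proj₁)
open import Data.Sum using (_⊎_)
open import Relation.Binary.PropositionalEquality using (_≡_)
open import Relation.Binary.Construct.Closure.ReflexiveTransitive using (Star)
open import Relation.Nullary using (¬_)

-- A finite digraph on vertex set Fin n, given by its (Boolean) adjacency
-- relation: E u v ≡ true iff there is an arc u → v.  Using a relation
-- rules out multiple arcs automatically.
Digraph : ℕ → Set
Digraph n = Fin n → Fin n → Bool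

count : ∀ {n} → (Fin n → Bool) → ℕ
count {zero}  p = 0
count {suc n} p = (if p zero then 1 else 0) + count (λ i → p (suc i))

module _ {n : ℕ} (E : Digraph n) where

  Arc : Fin n → Fin n → Set
  Arc u v = E u v ≡ true

  indeg : Fin n → ℕ
  indeg v = count (λ u → E u v)

  outdeg : Fin n → ℕ
  outdeg u = count (λ v → E u v)

  DPath : Fin n → Fin n → Set
  DPath = Star Arc

  Loopless : Set
  Loopless = ∀ v → E v v ≡ false

  Acyclic : Set
  Acyclic = ∀ u v → Arc u v → ¬ DPath v u

  UAdj : Fin n → Fin n → Set
  UAdj u v = Arc u v ⊎ Arc v u

  UConnected : Set
  UConnected = ∀ u v → Star UAdj u v

  UCycle : Set
  UCycle = Σ (Fin n) λ x → Σ (List (Fin n)) λ xs →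
             (3 ≤ length (x ∷ xs)) × Unique (x ∷ xs) × Linked UAdj ((x ∷ xs) ∷ʳ x)

  IsLeaf : Fin n → Set
  IsLeaf v = (indeg v ≡ 1) × (outdeg v ≡ 0)

  Leaf : Set
  Leaf = Σ (Fin n) IsLeaf

  record IsNetwork : Set where
    field
      loopless   : Loopless
      acyclic    : Acyclic
      connected  : UConnected
      twoLeaves  : 2 ≤ count (λ v → (indeg v Data.Nat.≡ᵇ 1) Data.Bool.∧ (outdeg v Data.Nat.≡ᵇ 0))
      rootOut    : ∀ v → indeg v ≡ 0 → 2 ≤ outdeg v
      sinkLeaf   : ∀ v → outdeg v ≡ 0 → indeg v ≡ 1
      noSubdiv   : ∀ v → ¬ ((indeg v ≡ 1) × (outdeg v ≡ 1))

  Arboreal : Set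
  Arboreal = UConnected × ¬ UCycle

  SharedAncestryAdj : Leaf → Leaf → Set
  SharedAncestryAdj x y =
    ¬ (proj₁ x ≡ proj₁ y) × ∃[ w ] (DPath w (proj₁ x) × DPath w (proj₁ y))

module _ {V : Set} (Adj : V → V → Set) where

  data Walk : V → V → ℕ → Set where
    here : ∀ {x} → Walk x x 0
    step : ∀ {x y z k} → Adj x y → Walk y z k → Walk x z (suc k)

  IsDist : V → V → ℕ → Set
  IsDist x y k = Walk x y k × (∀ m → Walk x y m → k ≤ m)

  Connected : Set
  Connected = ∀ x y → ∃[ k ] Walk x y k

  Ptolemaic : Set
  Ptolemaic = Connected ×
    (∀ x y z u {dxy dzu dxu dyz dxz dyu} →
       IsDist x y dxy → IsDist z u dzu → IsDist x u dxu →
       IsDist y z dyz → IsDist x z dxz → IsDist y u dyu →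
       dxz * dyu ≤ dxy * dzu + dxu * dyz)

{-# OPTIONS --safe #-}
-- In an arboreal network two vertices are joined by a unique simple path of the underlying tree.
-- Call a vertex of such a path a peak if both of its neighbours on the path are its children.
-- The distance in 𝒜(N) between two leaves is the number of peaks on the path between them: an
-- edge x — y of 𝒜 is an ascent from x to a common ancestor followed by a descent to y, which
-- creates one peak, and erasing loops from a walk never creates peaks; conversely the peaks of
-- the path can be visited by 𝒜 one at a time.  Four leaves span a subtree with one centre, or
-- with two centres joined by a middle path, and each distance is a sum of peak counts of arms
-- plus at most one peak per centre.  The Ptolemy inequalities then become inequalities in ℕ,
-- which follow from (p + r + m)(q + s + m) − (p + s + m)(q + r + m) = (p − q)(r − s) and a case
-- analysis on the orientation of the arms at the centres.
module Submission where

open import Defs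
open import Data.Bool using (Bool; true; false; _∧_; not)
open import Data.Bool.Properties using (not-¬; ∧-comm; ∧-zeroʳ)
open import Data.Empty using (⊥; ⊥-elim)
open import Data.Fin using (Fin; zero; suc)
open import Data.Fin.Induction using (spo-wellFounded)
open import Data.Fin.Properties using () renaming (_≟_ to _≟ᶠ_)
open import Data.List using (List; []; _∷_; _++_; [_]; _∷ʳ_; reverse; length)
open import Data.List.Properties using (++-assoc; unfold-reverse; length-++; ∷-injectiveˡ)
open import Data.List.Membership.Propositional using (_∈_; _∉_)
open import Data.List.Membership.Propositional.Properties using (∈-++⁺ˡ; ∈-++⁺ʳ; ∈-++⁻; ∈-∃++)
import Data.List.Membership.DecPropositional as DecMembership
open import Data.List.Relation.Unary.All.Properties.Core using (¬Any⇒All¬)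
open import Data.List.Relation.Unary.AllPairs.Core using ([]; _∷_)
open import Data.List.Relation.Unary.Any using (here; there)
open import Data.List.Relation.Unary.Any.Properties using (reverse⁻)
open import Data.List.Relation.Unary.Linked using (Linked; []; [-]; _∷_)
open import Data.List.Relation.Unary.Unique.Propositional using (Unique)
open import Data.Nat using (ℕ; zero; suc; _+_; _*_; _≤_; _<_; z≤n; s≤s; s≤s⁻¹)
open import Data.Nat.Properties
open import Data.Nat.Tactic.RingSolver using (solve-∀)
open import Data.Product using (Σ; ∃; _×_; _,_; proj₁; proj₂)
open import Data.Sum using (_⊎_; inj₁; inj₂; [_,_]′)
open import Data.Unit using (⊤; tt)
open import Function using (id; flip; _∘_)
open import Induction.WellFounded using (Acc; acc)
open import Relation.Binary.Construct.Closure.ReflexiveTransitive using (Star; ε; _◅_; _◅◅_) renaming (reverse to Star-reverse)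
open import Relation.Binary.Construct.Closure.Transitive as Plus using (TransClosure) renaming ([_] to [_]⁺; _∷_ to _∷⁺_)
open import Relation.Binary.PropositionalEquality hiding ([_])
open import Relation.Binary.Structures using (IsStrictPartialOrder)
open import Relation.Nullary using (¬_; Dec; yes; no; contradiction)
open import Relation.Nullary.Decidable using (_⊎-dec_)

count≡0⇒false : ∀ {n} (p : Fin n → Bool) → count p ≡ 0 → ∀ i → p i ≡ false
count≡0⇒false {suc n} p h i with p zero in eq
count≡0⇒false {suc n} p h zero    | false = eq
count≡0⇒false {suc n} p h (suc i) | false = count≡0⇒false (λ j → p (suc j)) h i

count≡0⊎witness : ∀ {n} (p : Fin n → Bool) → count p ≡ 0 ⊎ ∃ λ i → p i ≡ true
count≡0⊎witness {zero} p = inj₁ refl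
count≡0⊎witness {suc n} p with p zero in eq
... | true = inj₂ (zero , eq)
... | false with count≡0⊎witness (λ j → p (suc j))
...   | inj₁ z = inj₁ z
...   | inj₂ (i , q) = inj₂ (suc i , q)

count≡1⇒unique : ∀ {n} (p : Fin n → Bool) → count p ≡ 1 → ∀ i j → p i ≡ true → p j ≡ true → i ≡ j
count≡1⇒unique {suc n} p h i j pi pj with p zero in eq
count≡1⇒unique {suc n} p h zero    zero    pi pj | _     = refl
count≡1⇒unique {suc n} p h zero    (suc j) pi pj | true  =
  ⊥-elim (not-¬ pj (count≡0⇒false (λ k → p (suc k)) (suc-injective h) j))
count≡1⇒unique {suc n} p h zero    (suc j) pi pj | false = ⊥-elim (not-¬ pi eq)
count≡1⇒unique {suc n} p h (suc i) j       pi pj | true  =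
  ⊥-elim (not-¬ pi (count≡0⇒false (λ k → p (suc k)) (suc-injective h) i))
count≡1⇒unique {suc n} p h (suc i) zero    pi pj | false = ⊥-elim (not-¬ pj eq)
count≡1⇒unique {suc n} p h (suc i) (suc j) pi pj | false =
  cong suc (count≡1⇒unique (λ k → p (suc k)) h i j pi pj)

module Leaves {n : ℕ} {E : Digraph n} (net : IsNetwork E) where
  open IsNetwork net

  arc-asym : ∀ {a b} → Arc E a b → Arc E b a → ⊥
  arc-asym h h′ = acyclic _ _ h (h′ ◅ ε)

  leaf-noArcFrom : ∀ {l} → IsLeaf E l → ∀ w → E l w ≡ false
  leaf-noArcFrom lf = count≡0⇒false (E _) (proj₂ lf)

  leaf-uniqueParent : ∀ {l a b} → IsLeaf E l → Arc E a l → Arc E b l → a ≡ b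
  leaf-uniqueParent {l} lf = count≡1⇒unique (λ u → E u l) (proj₁ lf) _ _

  leaf-pathFrom : ∀ {l w} → IsLeaf E l → DPath E l w → l ≡ w
  leaf-pathFrom lf ε = refl
  leaf-pathFrom lf (h ◅ _) = ⊥-elim (not-¬ h (leaf-noArcFrom lf _))

  Leaf-≡ : (x y : Leaf E) → proj₁ x ≡ proj₁ y → x ≡ y
  Leaf-≡ (a , p₁ , p₂) (.a , q₁ , q₂) refl
    rewrite ≡-irrelevant p₁ q₁ | ≡-irrelevant p₂ q₂ = refl

  leaf-neighbour⇒parent : ∀ {l a} → IsLeaf E l → UAdj E l a → Arc E a l
  leaf-neighbour⇒parent lf (inj₁ h) = ⊥-elim (not-¬ h (leaf-noArcFrom lf _))
  leaf-neighbour⇒parent lf (inj₂ h) = h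

  leaf-uniqueNeighbour : ∀ {l a b} → IsLeaf E l → UAdj E l a → UAdj E l b → a ≡ b
  leaf-uniqueNeighbour lf h₁ h₂ =
    leaf-uniqueParent lf (leaf-neighbour⇒parent lf h₁) (leaf-neighbour⇒parent lf h₂)

  _⊏_ : Fin n → Fin n → Set
  w ⊏ v = TransClosure (Arc E) v w

  plus⇒path : ∀ {a b} → TransClosure (Arc E) a b → DPath E a b
  plus⇒path [ h ]⁺ = h ◅ ε
  plus⇒path (h ∷⁺ t) = h ◅ plus⇒path t

  ⊏-irreflexive : ∀ {a} → TransClosure (Arc E) a a → ⊥
  ⊏-irreflexive {a} [ h ]⁺ = not-¬ h (loopless a)
  ⊏-irreflexive (h ∷⁺ t) = acyclic _ _ h (plus⇒path t)

  ⊏-isStrictPartialOrder : IsStrictPartialOrder _≡_ _⊏_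
  ⊏-isStrictPartialOrder = record
    { isEquivalence = isEquivalence
    ; irrefl = λ { refl t → ⊏-irreflexive t }
    ; trans = λ t₁ t₂ → t₂ Plus.++ t₁
    ; <-resp-≈ = (λ { refl h → h }) , (λ { refl h → h })
    }

  leafBelow : ∀ v → Σ (Fin n) λ l → IsLeaf E l × DPath E v l
  leafBelow v = go v (spo-wellFounded ⊏-isStrictPartialOrder v)
    where
      go : ∀ v → Acc _⊏_ v → Σ (Fin n) λ l → IsLeaf E l × DPath E v l
      go v (acc rec) with count≡0⊎witness (E v)
      ... | inj₁ z = v , (sinkLeaf v z , z) , ε
      ... | inj₂ (w , h) with go w (rec [ h ]⁺)
      ...   | l , lf , p = l , lf , h ◅ p

𝟙 : Bool → ℕ
𝟙 true = 1
𝟙 false = 0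

𝟙≤1 : ∀ b → 𝟙 b ≤ 1
𝟙≤1 true = s≤s z≤n
𝟙≤1 false = z≤n

-- An arm has a peaks and its first arc points
-- away from the centre iff e; two arms glued at the centre get a peak there iff both point away
-- (junction), and leg is an arm glued to a path whose first arc is oriented by f.  An arm that
-- starts upwards must contain a peak before it reaches its leaf (Arm).
Arm : ℕ → Bool → Set
Arm a e = e ≡ false → 1 ≤ a

leg : ℕ → Bool → Bool → ℕ
leg a e f = a + 𝟙 (e ∧ f)

junction : ℕ → ℕ → Bool → Bool → ℕ
junction a b e e′ = a + b + 𝟙 (e ∧ e′)

module _ {A : Set} where

  Distinct : List A → Set
  Distinct [] = ⊤
  Distinct (x ∷ xs) = x ∉ xs × Distinct xs

  Disjoint : List A → List A → Set
  Disjoint xs ys = ∀ v → v ∈ xs → v ∈ ys → ⊥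

  Disjoint-sym : ∀ {xs ys} → Disjoint xs ys → Disjoint ys xs
  Disjoint-sym d v p q = d v q p

  -- A walk is given by its start a and the list rs of the vertices after it; end, next and
  -- penult (the last but one vertex) fall back to a when rs is too short.
  end : A → List A → A
  end a [] = a
  end a (b ∷ r) = end b r

  next : A → List A → A
  next a [] = a
  next a (b ∷ _) = b

  penult : A → List A → A
  penult a [] = a
  penult a (b ∷ []) = a
  penult a (b ∷ c ∷ r) = penult b (c ∷ r)

  end-++ : ∀ a rs ss → end a (rs ++ ss) ≡ end (end a rs) ss
  end-++ a [] ss = refl
  end-++ a (r ∷ rs) ss = end-++ r rs ss

  end∈ : ∀ a rs → end a rs ∈ a ∷ rs
  end∈ a [] = here refl
  end∈ a (r ∷ rs) = there (end∈ r rs)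

  Distinct-++ : ∀ xs ys → Distinct xs → Distinct ys → Disjoint xs ys → Distinct (xs ++ ys)
  Distinct-++ [] ys d₁ d₂ d = d₂
  Distinct-++ (x ∷ xs) ys (x∉ , d₁) d₂ d =
    (λ p → [ x∉ , d x (here refl) ]′ (∈-++⁻ xs p)) ,
    Distinct-++ xs ys d₁ d₂ (λ v p q → d v (there p) q)

  Distinct-prefix : ∀ xs ys → Distinct (xs ++ ys) → Distinct xs
  Distinct-prefix [] ys d = tt
  Distinct-prefix (x ∷ xs) ys (x∉ , d) = (λ p → x∉ (∈-++⁺ˡ p)) , Distinct-prefix xs ys d

  Distinct-suffix : ∀ xs ys → Distinct (xs ++ ys) → Distinct ys
  Distinct-suffix [] ys d = d
  Distinct-suffix (x ∷ xs) ys (_ , d) = Distinct-suffix xs ys d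

  Distinct-++⇒Disjoint : ∀ xs ys → Distinct (xs ++ ys) → Disjoint xs ys
  Distinct-++⇒Disjoint (x ∷ xs) ys (x∉ , d) v (here refl) q = x∉ (∈-++⁺ʳ xs q)
  Distinct-++⇒Disjoint (x ∷ xs) ys (x∉ , d) v (there p) q = Distinct-++⇒Disjoint xs ys d v p q

  Distinct-reverse : ∀ L → Distinct L → Distinct (reverse L)
  Distinct-reverse [] d = tt
  Distinct-reverse (x ∷ L) (x∉ , d) = subst Distinct (sym (unfold-reverse x L))
    (Distinct-++ (reverse L) [ x ] (Distinct-reverse L d) ((λ ()) , tt)
      (λ { v p (here refl) → x∉ (reverse⁻ p) }))

  reversedTail : A → List A → List A
  reversedTail a [] = []
  reversedTail a (r ∷ rs) = reversedTail r rs ∷ʳ a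

  reverse-∷ : ∀ a rs → reverse (a ∷ rs) ≡ end a rs ∷ reversedTail a rs
  reverse-∷ a [] = refl
  reverse-∷ a (r ∷ rs) = trans (unfold-reverse a (r ∷ rs)) (cong (_∷ʳ a) (reverse-∷ r rs))

  end-reversedTail : ∀ a rs → end (end a rs) (reversedTail a rs) ≡ a
  end-reversedTail a [] = refl
  end-reversedTail a (r ∷ rs) = end-++ (end r rs) (reversedTail r rs) [ a ]

  next-∷ʳ-∷ʳ : ∀ l W r a → next l ((W ∷ʳ r) ∷ʳ a) ≡ next l (W ∷ʳ r)
  next-∷ʳ-∷ʳ l [] r a = refl
  next-∷ʳ-∷ʳ l (w ∷ W) r a = refl

  next-reversedTail : ∀ a rs → next (end a rs) (reversedTail a rs) ≡ penult a rs
  next-reversedTail a [] = refl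
  next-reversedTail a (r ∷ []) = refl
  next-reversedTail a (r ∷ r′ ∷ rs) =
    trans (next-∷ʳ-∷ʳ _ (reversedTail r′ rs) r a) (next-reversedTail r (r′ ∷ rs))

  penult-∷ʳ : ∀ l X a → penult l (X ∷ʳ a) ≡ end l X
  penult-∷ʳ l [] a = refl
  penult-∷ʳ l (x ∷ []) a = refl
  penult-∷ʳ l (x ∷ x′ ∷ X) a = penult-∷ʳ x (x′ ∷ X) a

  penult-reversedTail : ∀ a rs → penult (end a rs) (reversedTail a rs) ≡ next a rs
  penult-reversedTail a [] = refl
  penult-reversedTail a (r ∷ rs) = trans (penult-∷ʳ _ (reversedTail r rs) a) (end-reversedTail r rs)

  firstHit : (T : A → Set) → (∀ v → Dec (T v)) → ∀ a rs → T (end a rs) →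
             Σ (List A) λ rs₁ → Σ (List A) λ rs₂ → rs ≡ rs₁ ++ rs₂ × T (end a rs₁) ×
             (∀ v → v ∈ a ∷ rs₁ → T v → v ≡ end a rs₁)
  firstHit T T? a rs t with T? a
  ... | yes ta = [] , rs , refl , ta , (λ { v (here refl) _ → refl })
  firstHit T T? a [] t | no ¬ta = ⊥-elim (¬ta t)
  firstHit T T? a (r ∷ rs) t | no ¬ta with firstHit T T? r rs t
  ... | rs₁ , rs₂ , eq , tl , first =
        (r ∷ rs₁) , rs₂ , cong (r ∷_) eq , tl ,
        (λ { v (here refl) tv → ⊥-elim (¬ta tv) ; v (there q) tv → first v q tv })

  Distinct⇒Unique : ∀ L → Distinct L → Unique L
  Distinct⇒Unique [] _ = []
  Distinct⇒Unique (x ∷ L) (x∉ , d) = ¬Any⇒All¬ L x∉ ∷ Distinct⇒Unique L d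

  reversedTail-⊆ : ∀ s Q {v} → v ∈ reversedTail s Q → v ∈ s ∷ Q
  reversedTail-⊆ s Q p = reverse⁻ (subst (_ ∈_) (sym (reverse-∷ s Q)) (there p))

module Walks {n : ℕ} (E : Digraph n) where

  V : Set
  V = Fin n

  UAdj-sym : ∀ {a b} → UAdj E a b → UAdj E b a
  UAdj-sym (inj₁ h) = inj₂ h
  UAdj-sym (inj₂ h) = inj₁ h

  Chain : List V → Set
  Chain (a ∷ b ∷ r) = UAdj E a b × Chain (b ∷ r)
  Chain _ = ⊤

  peaksFrom : V → V → List V → ℕ
  peaksFrom a b [] = 0
  peaksFrom a b (c ∷ r) = 𝟙 (E b a ∧ E b c) + peaksFrom b c r

  peaks : List V → ℕ
  peaks (a ∷ b ∷ r) = peaksFrom a b r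
  peaks _ = 0

  peaks-dup : Loopless E → ∀ x L → peaks (x ∷ x ∷ L) ≡ peaks (x ∷ L)
  peaks-dup loopless x [] = refl
  peaks-dup loopless x (l ∷ L) rewrite loopless x = refl

  peaksFrom-split : ∀ a b ws x y zs →
    peaksFrom a b (ws ++ x ∷ y ∷ zs) ≡ peaksFrom a b (ws ++ x ∷ [ y ]) + peaksFrom x y zs
  peaksFrom-split a b [] x y zs =
    trans (sym (+-assoc (𝟙 (E b a ∧ E b x)) _ _))
          (cong (λ t → 𝟙 (E b a ∧ E b x) + t + peaksFrom x y zs) (sym (+-identityʳ _)))
  peaksFrom-split a b (w ∷ ws) x y zs =
    trans (cong (𝟙 (E b a ∧ E b w) +_) (peaksFrom-split b w ws x y zs))
          (sym (+-assoc (𝟙 (E b a ∧ E b w)) _ _))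

  peaks-split : ∀ ws x y zs → peaks (ws ++ x ∷ y ∷ zs) ≡ peaks (ws ++ x ∷ [ y ]) + peaks (x ∷ y ∷ zs)
  peaks-split [] x y zs = refl
  peaks-split (w ∷ []) x y zs = cong (_+ peaksFrom x y zs) (sym (+-identityʳ _))
  peaks-split (w ∷ w′ ∷ ws) x y zs = peaksFrom-split w w′ ws x y zs

  peaks-reverse-∷ʳ : ∀ x L → peaks (reverse L ∷ʳ x) ≡ peaks (x ∷ L)
  peaks-reverse-∷ʳ x [] = refl
  peaks-reverse-∷ʳ x (y ∷ []) = refl
  peaks-reverse-∷ʳ x (y ∷ z ∷ L) = begin
      peaks (reverse (y ∷ z ∷ L) ∷ʳ x)
    ≡⟨ cong (λ t → peaks (t ∷ʳ x)) (trans (unfold-reverse y (z ∷ L)) (cong (_∷ʳ y) (unfold-reverse z L))) ⟩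
      peaks (((reverse L ∷ʳ z) ∷ʳ y) ∷ʳ x)
    ≡⟨ cong peaks (trans (++-assoc (reverse L ∷ʳ z) [ y ] [ x ]) (++-assoc (reverse L) [ z ] (y ∷ [ x ]))) ⟩
      peaks (reverse L ++ z ∷ y ∷ [ x ])
    ≡⟨ peaks-split (reverse L) z y [ x ] ⟩
      peaks (reverse L ++ z ∷ [ y ]) + (𝟙 (E y z ∧ E y x) + 0)
    ≡⟨ cong (λ t → peaks t + (𝟙 (E y z ∧ E y x) + 0))
            (trans (sym (++-assoc (reverse L) [ z ] [ y ])) (cong (_∷ʳ y) (sym (unfold-reverse z L)))) ⟩
      peaks (reverse (z ∷ L) ∷ʳ y) + (𝟙 (E y z ∧ E y x) + 0)
    ≡⟨ cong₂ _+_ (peaks-reverse-∷ʳ y (z ∷ L)) (trans (+-identityʳ _) (cong 𝟙 (∧-comm (E y z) (E y x)))) ⟩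
      peaksFrom y z L + 𝟙 (E y x ∧ E y z)
    ≡⟨ +-comm (peaksFrom y z L) _ ⟩
      peaks (x ∷ y ∷ z ∷ L) ∎
    where open ≡-Reasoning

  peaks-reverse : ∀ L → peaks (reverse L) ≡ peaks L
  peaks-reverse [] = refl
  peaks-reverse (x ∷ L) = trans (cong peaks (unfold-reverse x L)) (peaks-reverse-∷ʳ x L)

  Chain-∷ʳ : ∀ ws r y → Chain (ws ∷ʳ r) → UAdj E r y → Chain (ws ++ r ∷ [ y ])
  Chain-∷ʳ [] r y c h = h , tt
  Chain-∷ʳ (w ∷ []) r y (h₁ , _) h = h₁ , h , tt
  Chain-∷ʳ (w ∷ w′ ∷ ws) r y (h₁ , c) h = h₁ , Chain-∷ʳ (w′ ∷ ws) r y c h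

  Chain-reverse : ∀ x rs → Chain (x ∷ rs) → Chain (reverse (x ∷ rs))
  Chain-reverse x [] c = tt
  Chain-reverse x (r ∷ rs) (h , c) =
    subst Chain (sym (trans (unfold-reverse x (r ∷ rs)) (cong (_∷ʳ x) (unfold-reverse r rs))))
      (subst Chain (sym (++-assoc (reverse rs) [ r ] [ x ]))
        (Chain-∷ʳ (reverse rs) r x (subst Chain (unfold-reverse r rs) (Chain-reverse r rs c)) (UAdj-sym h)))

  Chain-++ : ∀ x rs ys → Chain (x ∷ rs) → Chain (end x rs ∷ ys) → Chain (x ∷ rs ++ ys)
  Chain-++ x [] ys c₁ c₂ = c₂
  Chain-++ x (r ∷ rs) ys (h , c₁) c₂ = h , Chain-++ r rs ys c₁ c₂

  Chain-prefix : ∀ x rs ys → Chain (x ∷ rs ++ ys) → Chain (x ∷ rs)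
  Chain-prefix x [] ys c = tt
  Chain-prefix x (r ∷ rs) ys (h , c) = h , Chain-prefix r rs ys c

  Chain-suffix : ∀ x rs ys → Chain (x ∷ rs ++ ys) → Chain (end x rs ∷ ys)
  Chain-suffix x [] ys c = c
  Chain-suffix x (r ∷ rs) ys (h , c) = Chain-suffix r rs ys c

  -- the last term is the peak (if any) at the junction vertex end a rs
  peaks-++ : Loopless E → ∀ a rs ss → peaks (a ∷ rs ++ ss) ≡ peaks (a ∷ rs) + peaks (end a rs ∷ ss)
               + 𝟙 (E (end a rs) (penult a rs) ∧ E (end a rs) (next (end a rs) ss))
  peaks-++ loopless a [] ss rewrite loopless a = sym (+-identityʳ _)
  peaks-++ loopless a (r ∷ []) [] rewrite loopless r = cong 𝟙 (∧-comm false (E r a))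
  peaks-++ loopless a (r ∷ []) (s ∷ ss) = +-comm (𝟙 (E r a ∧ E r s)) _
  peaks-++ loopless a (r ∷ r′ ∷ rs) ss =
    trans (cong (i +_) (peaks-++ loopless r (r′ ∷ rs) ss))
      (trans (sym (+-assoc i (X + Y) J′)) (cong (_+ J′) (sym (+-assoc i X Y))))
    where
      l : V
      l = end r (r′ ∷ rs)
      i X Y J′ : ℕ
      i = 𝟙 (E r a ∧ E r r′)
      X = peaks (r ∷ r′ ∷ rs)
      Y = peaks (l ∷ ss)
      J′ = 𝟙 (E l (penult r (r′ ∷ rs)) ∧ E l (next l ss))

module Paths {n : ℕ} {E : Digraph n} (net : IsNetwork E) where
  open IsNetwork net
  open Leaves net
  open Walks E public
  open DecMembership (_≟ᶠ_ {n}) using (_∈?_)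

  reverseArc : ∀ {b c} → E b c ≡ false → UAdj E b c → Arc E c b
  reverseArc f (inj₁ h) = ⊥-elim (not-¬ h f)
  reverseArc f (inj₂ h) = h

  arc⇒noReverseArc : ∀ {a b} → Arc E a b → E b a ≡ false
  arc⇒noReverseArc {a} {b} h with E b a in eq
  ... | true = ⊥-elim (arc-asym h eq)
  ... | false = refl

  up-down⇒peak : ∀ a rs → Chain (a ∷ rs) → Arc E (next a rs) a → Arc E (penult a rs) (end a rs) →
                 1 ≤ peaks (a ∷ rs)
  up-down⇒peak a [] ch h₁ h₂ = ⊥-elim (not-¬ h₁ (loopless a))
  up-down⇒peak a (b ∷ []) ch h₁ h₂ = ⊥-elim (arc-asym h₁ h₂)
  up-down⇒peak a (b ∷ c ∷ r) (_ , inj₁ bc , _) h₁ h₂ rewrite h₁ | bc = s≤s z≤n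
  up-down⇒peak a (b ∷ c ∷ r) (_ , ch@(inj₂ cb , _)) h₁ h₂ =
    ≤-trans (up-down⇒peak b (c ∷ r) ch cb h₂) (m≤n+m _ _)

  peakFree⇒ascending : ∀ v₀ v₁ r → Chain (v₀ ∷ v₁ ∷ r) → peaksFrom v₀ v₁ r ≡ 0 → Arc E v₁ v₀ →
                       DPath E (end v₁ r) v₁
  peakFree⇒ascending v₀ v₁ [] ch z h = ε
  peakFree⇒ascending v₀ v₁ (v₂ ∷ r) (_ , inj₁ v₁v₂ , _) z h rewrite h | v₁v₂ = contradiction z λ ()
  peakFree⇒ascending v₀ v₁ (v₂ ∷ r) (_ , ch@(inj₂ v₂v₁ , _)) z h =
    peakFree⇒ascending v₁ v₂ r ch (m+n≡0⇒n≡0 (𝟙 (E v₁ v₀ ∧ E v₁ v₂)) z) v₂v₁ ◅◅ (v₂v₁ ◅ ε)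

  closedPeakFree⇒startsDown : ∀ a c rs → Chain (a ∷ c ∷ rs) → end c rs ≡ a → peaks (a ∷ c ∷ rs) ≡ 0 →
                              Arc E a c
  closedPeakFree⇒startsDown a c rs (inj₁ ac , _) closed z = ac
  closedPeakFree⇒startsDown a c rs ch@(inj₂ ca , _) closed z =
    ⊥-elim (acyclic c a ca (subst (λ t → DPath E t c) closed (peakFree⇒ascending a c rs ch z ca)))

  closedPeakFree⇒endsUp : ∀ a c rs → Chain (a ∷ c ∷ rs) → end c rs ≡ a → peaks (a ∷ c ∷ rs) ≡ 0 →
                          Arc E a (penult a (c ∷ rs))
  closedPeakFree⇒endsUp a c rs ch closed z =
    subst (λ t → Arc E a t) second≡penult (closedPeakFree⇒startsDown a q W ch′ closed′ z′)
    where
      nonempty : ∀ (X : List V) → Σ (List V) λ W → X ∷ʳ a ≡ next a (X ∷ʳ a) ∷ W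
      nonempty [] = [] , refl
      nonempty (x ∷ X) = X ∷ʳ a , refl
      L : List V
      L = reversedTail c rs ∷ʳ a
      q : V
      q = next a L
      W : List V
      W = proj₁ (nonempty (reversedTail c rs))
      reversed : reverse (a ∷ c ∷ rs) ≡ a ∷ q ∷ W
      reversed = trans (reverse-∷ a (c ∷ rs)) (cong₂ _∷_ closed (proj₂ (nonempty (reversedTail c rs))))
      ch′ : Chain (a ∷ q ∷ W)
      ch′ = subst Chain reversed (Chain-reverse a (c ∷ rs) ch)
      z′ : peaks (a ∷ q ∷ W) ≡ 0
      z′ = trans (cong peaks (sym reversed)) (trans (peaks-reverse (a ∷ c ∷ rs)) z)
      closed′ : end q W ≡ a
      closed′ = trans (cong (end a) (sym (proj₂ (nonempty (reversedTail c rs)))))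
                  (trans (cong (λ t → end t L) (sym closed)) (end-reversedTail a (c ∷ rs)))
      second≡penult : q ≡ penult a (c ∷ rs)
      second≡penult = trans (cong (λ t → next t L) (sym closed)) (next-reversedTail a (c ∷ rs))

  -- If the loop at a has no peak it leaves a downwards and returns from below, so a peak at a
  -- on the shortcut is a peak at one of a's two visits on the long walk.
  peaks-cutLoop : ∀ p a C R → Chain (a ∷ C ++ a ∷ R) → peaks (p ∷ a ∷ R) ≤ peaks (p ∷ a ∷ C ++ a ∷ R)
  peaks-cutLoop p a [] R (h , _) = ⊥-elim (not-¬ ([ id , id ]′ h) (loopless a))
  peaks-cutLoop p a (c ∷ C) [] ch = z≤n
  peaks-cutLoop p a (c ∷ C) (r ∷ R) ch = byLoopPeaks (X + J′ ≟ 0)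
    where
      open ≤-Reasoning
      cl : V
      cl = end c C
      X J′ T i₀ i₁ i₂ : ℕ
      X = peaks (a ∷ c ∷ C)
      J′ = 𝟙 (E cl (penult a (c ∷ C)) ∧ E cl a)
      T = peaksFrom a r R
      i₀ = 𝟙 (E a p ∧ E a c)
      i₁ = 𝟙 (E a p ∧ E a r)
      i₂ = 𝟙 (E a cl ∧ E a r)
      𝟙-∧-split : ∀ x y {z w} → z ≡ true → w ≡ true → 𝟙 (x ∧ y) ≤ 𝟙 (x ∧ z) + 𝟙 (w ∧ y)
      𝟙-∧-split true true refl refl = s≤s z≤n
      𝟙-∧-split true false refl refl = z≤n
      𝟙-∧-split false y refl refl = z≤n
      regroup : ∀ a b x j t → a + b + (x + j + t) ≡ a + (x + (b + t) + j)
      regroup = solve-∀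
      rearrange : i₀ + i₂ + (X + J′ + T) ≡ peaks (p ∷ a ∷ (c ∷ C) ++ a ∷ r ∷ R)
      rearrange = trans (regroup i₀ i₂ X J′ T) (cong (i₀ +_) (sym (peaks-++ loopless a (c ∷ C) (a ∷ r ∷ R))))
      loop : Chain (a ∷ c ∷ C ++ [ a ])
      loop = Chain-prefix a (c ∷ C ++ [ a ]) (r ∷ R)
               (subst (λ t → Chain (a ∷ t)) (sym (cong (c ∷_) (++-assoc C [ a ] (r ∷ R)))) ch)
      loopPeaks : X + J′ ≡ 0 → peaks (a ∷ c ∷ C ++ [ a ]) ≡ 0
      loopPeaks z = trans (peaks-++ loopless a (c ∷ C) [ a ]) (trans (cong (_+ J′) (+-identityʳ X)) z)
      startsDown : X + J′ ≡ 0 → E a c ≡ true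
      startsDown z = closedPeakFree⇒startsDown a c (C ++ [ a ]) loop (end-++ c C [ a ]) (loopPeaks z)
      endsUp : X + J′ ≡ 0 → E a cl ≡ true
      endsUp z = subst (λ t → Arc E a t) (penult-∷ʳ a (c ∷ C) a)
                   (closedPeakFree⇒endsUp a c (C ++ [ a ]) loop (end-++ c C [ a ]) (loopPeaks z))
      byLoopPeaks : Dec (X + J′ ≡ 0) → i₁ + T ≤ peaks (p ∷ a ∷ (c ∷ C) ++ a ∷ r ∷ R)
      byLoopPeaks (no pos) = begin
        i₁ + T                    ≤⟨ +-monoˡ-≤ T (≤-trans (𝟙≤1 (E a p ∧ E a r)) (n≢0⇒n>0 pos)) ⟩
        X + J′ + T                ≤⟨ m≤n+m (X + J′ + T) (i₀ + i₂) ⟩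
        i₀ + i₂ + (X + J′ + T)    ≡⟨ rearrange ⟩
        peaks (p ∷ a ∷ (c ∷ C) ++ a ∷ r ∷ R) ∎
      byLoopPeaks (yes peakFree) = begin
        i₁ + T                    ≤⟨ +-monoˡ-≤ T (𝟙-∧-split (E a p) (E a r) (startsDown peakFree) (endsUp peakFree)) ⟩
        i₀ + i₂ + T               ≤⟨ +-monoʳ-≤ (i₀ + i₂) (m≤n+m T (X + J′)) ⟩
        i₀ + i₂ + (X + J′ + T)    ≡⟨ rearrange ⟩
        peaks (p ∷ a ∷ (c ∷ C) ++ a ∷ r ∷ R) ∎

  record SimplePath (a b : V) (k : ℕ) : Set where
    constructor path
    field
      steps : List V
      chain : Chain (a ∷ steps)
      distinct : Distinct (a ∷ steps)
      ends : end a steps ≡ b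
      peaks≡ : peaks (a ∷ steps) ≡ k
  open SimplePath public

  SimplePath-reverse : ∀ {a b k} → SimplePath a b k → SimplePath b a k
  SimplePath-reverse {a} (path rs c d refl refl) =
    path (reversedTail a rs) (subst Chain (reverse-∷ a rs) (Chain-reverse a rs c))
      (subst Distinct (reverse-∷ a rs) (Distinct-reverse _ d)) (end-reversedTail a rs)
      (trans (cong peaks (sym (reverse-∷ a rs))) (peaks-reverse (a ∷ rs)))

  reverse-penult : ∀ {a b k} (P : SimplePath a b k) → penult b (steps (SimplePath-reverse P)) ≡ next a (steps P)
  reverse-penult {a} (path rs c d refl refl) = penult-reversedTail a rs

  reverse-∈ : ∀ {a b k} (P : SimplePath a b k) {v} → v ∈ b ∷ steps (SimplePath-reverse P) → v ∈ a ∷ steps P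
  reverse-∈ {a} (path rs c d refl refl) p = reverse⁻ (subst (_ ∈_) (sym (reverse-∷ a rs)) p)

  SimplePath-++ : ∀ {a b c k₁ k₂} (P : SimplePath a c k₁) (Q : SimplePath c b k₂) → Disjoint (a ∷ steps P) (steps Q) →
                 SimplePath a b (k₁ + k₂ + 𝟙 (E c (penult a (steps P)) ∧ E c (next c (steps Q))))
  SimplePath-++ {a} (path rs₁ c₁ d₁ refl refl) (path rs₂ c₂ d₂ refl refl) d =
    path (rs₁ ++ rs₂) (Chain-++ a rs₁ rs₂ c₁ c₂) (Distinct-++ (a ∷ rs₁) rs₂ d₁ (proj₂ d₂) d)
      (end-++ a rs₁ rs₂) (peaks-++ loopless a rs₁ rs₂)

  ++-next : ∀ {a b c k₁ k₂} (P : SimplePath a c k₁) (Q : SimplePath c b k₂) (d : Disjoint (a ∷ steps P) (steps Q)) →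
            steps P ≢ [] → next a (steps (SimplePath-++ P Q d)) ≡ next a (steps P)
  ++-next (path [] _ _ refl refl) (path _ _ _ refl refl) d ne = ⊥-elim (ne refl)
  ++-next (path (r ∷ _) _ _ refl refl) (path _ _ _ refl refl) d ne = refl

  ++-∈⁻ : ∀ {a b c k₁ k₂} (P : SimplePath a c k₁) (Q : SimplePath c b k₂) (d : Disjoint (a ∷ steps P) (steps Q)) {v} →
          v ∈ steps (SimplePath-++ P Q d) → v ∈ steps P ⊎ v ∈ steps Q
  ++-∈⁻ (path rs₁ _ _ refl refl) (path _ _ _ refl refl) d p = ∈-++⁻ rs₁ p

  ++-∈⁺ˡ : ∀ {a b c k₁ k₂} (P : SimplePath a c k₁) (Q : SimplePath c b k₂) (d : Disjoint (a ∷ steps P) (steps Q)) {v} →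
           v ∈ steps P → v ∈ steps (SimplePath-++ P Q d)
  ++-∈⁺ˡ (path _ _ _ refl refl) (path _ _ _ refl refl) d p = ∈-++⁺ˡ p

  SimplePath-++-∈ : ∀ {a b c k₁ k₂} (P : SimplePath a c k₁) (Q : SimplePath c b k₂)
                    (d : Disjoint (a ∷ steps P) (steps Q)) →
                    c ∈ a ∷ steps (SimplePath-++ P Q d)
  SimplePath-++-∈ {a} P Q d with subst (_∈ a ∷ steps P) (ends P) (end∈ a (steps P))
  ... | here e = here e
  ... | there c∈P = there (++-∈⁺ˡ P Q d c∈P)

  prefixPath : ∀ a rs₁ rs₂ → Chain (a ∷ rs₁ ++ rs₂) → Distinct (a ∷ rs₁ ++ rs₂) →
               SimplePath a (end a rs₁) (peaks (a ∷ rs₁))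
  prefixPath a rs₁ rs₂ c d = path rs₁ (Chain-prefix a rs₁ rs₂ c) (Distinct-prefix (a ∷ rs₁) rs₂ d) refl refl

  suffixPath : ∀ a rs₁ rs₂ → Chain (a ∷ rs₁ ++ rs₂) → Distinct (a ∷ rs₁ ++ rs₂) →
               SimplePath (end a rs₁) (end a (rs₁ ++ rs₂)) (peaks (end a rs₁ ∷ rs₂))
  suffixPath a rs₁ rs₂ c d = path rs₂ (Chain-suffix a rs₁ rs₂ c)
    ((λ p → Distinct-++⇒Disjoint (a ∷ rs₁) rs₂ d _ (end∈ a rs₁) p) , Distinct-suffix (a ∷ rs₁) rs₂ d)
    (sym (end-++ a rs₁ rs₂)) refl

  subst-peaks : ∀ {a b k k′} → k ≡ k′ → SimplePath a b k → SimplePath a b k′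
  subst-peaks e (path rs c d l k) = path rs c d l (trans k e)

  subst-end : ∀ {a b b′ k} → b ≡ b′ → SimplePath a b k → SimplePath a b′ k
  subst-end e (path rs c d l k) = path rs c d (trans l e) k

  subst-start : ∀ {a a′ b k} → a ≡ a′ → SimplePath a b k → SimplePath a′ b k
  subst-start {b = b} {k} e (path rs c d l p) =
    path rs (subst (λ t → Chain (t ∷ rs)) e c) (subst (λ t → Distinct (t ∷ rs)) e d)
      (subst (λ t → end t rs ≡ b) e l) (subst (λ t → peaks (t ∷ rs) ≡ k) e p)

  SimplePath-nonempty : ∀ {a b k} (P : SimplePath a b k) → a ≢ b → steps P ≢ []
  SimplePath-nonempty (path [] _ _ e _) a≢b refl = a≢b e

  record Split {a b k} (P : SimplePath a b k) (v : V) : Set where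
    constructor split
    field
      k₁ k₂ : ℕ
      front : SimplePath a v k₁
      back : SimplePath v b k₂
      front⊆ : ∀ {w} → w ∈ steps front → w ∈ steps P
      back⊆ : ∀ {w} → w ∈ steps back → w ∈ steps P
      front#back : Disjoint (a ∷ steps front) (steps back)

  splitAt : ∀ {a b k} (P : SimplePath a b k) {v} → v ∈ a ∷ steps P → Split P v
  splitAt {a} (path rs c d e refl) {v} v∈P with cut a rs v∈P
    where
      cut : ∀ a rs → v ∈ a ∷ rs → Σ (List V) λ R₁ → Σ (List V) λ R₂ → rs ≡ R₁ ++ R₂ × end a R₁ ≡ v
      cut a rs (here e) = [] , rs , refl , sym e
      cut a (r ∷ rs) (there p) with cut r rs p
      ... | R₁ , R₂ , eq , e = r ∷ R₁ , R₂ , cong (r ∷_) eq , e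
  ... | R₁ , R₂ , refl , refl =
    split _ _ (prefixPath a R₁ R₂ c d) (subst-end e (suffixPath a R₁ R₂ c d)) ∈-++⁺ˡ (∈-++⁺ʳ R₁)
      (Distinct-++⇒Disjoint (a ∷ R₁) R₂ d)

  LoopErasure : V → List V → Set
  LoopErasure a rs = Σ (List V) λ ss → Chain (a ∷ ss) × Distinct (a ∷ ss) × end a ss ≡ end a rs ×
                       (∀ {v} → v ∈ ss → v ∈ rs) × (∀ p → peaks (p ∷ a ∷ ss) ≤ peaks (p ∷ a ∷ rs))

  loopErasure : ∀ fuel a rs → length rs < fuel → Chain (a ∷ rs) → LoopErasure a rs
  loopErasure (suc fuel) a rs lt ch with a ∈? rs
  ... | yes a∈rs with ∈-∃++ a∈rs
  ...   | C , R , refl with loopErasure fuel a R shorter (proj₂ (Chain-suffix a C (a ∷ R) ch))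
    where
      shorter : length R < fuel
      shorter = ≤-trans (m≤n+m (suc (length R)) (length C)) (≤-trans (≤-reflexive (sym (length-++ C))) (s≤s⁻¹ lt))
  ...     | ss , ch′ , d′ , e′ , sub , pk≤ =
            ss , ch′ , d′ , trans e′ (sym (end-++ a C (a ∷ R))) , (λ p → ∈-++⁺ʳ C (there (sub p))) ,
            (λ p → ≤-trans (pk≤ p) (peaks-cutLoop p a C R ch))
  loopErasure (suc fuel) a [] lt ch | no a∉rs = [] , tt , ((λ ()) , tt) , refl , (λ ()) , (λ p → ≤-refl)
  loopErasure (suc fuel) a (b ∷ rs) lt (h , ch) | no a∉rs with loopErasure fuel b rs (s≤s⁻¹ lt) ch
  ... | ss , ch′ , d′ , e′ , sub , pk≤ =
        (b ∷ ss) , (h , ch′) , ((λ { (here e) → a∉rs (here e) ; (there q) → a∉rs (there (sub q)) }) , d′) , e′ ,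
        (λ { (here e) → here e ; (there q) → there (sub q) }) , (λ p → +-monoʳ-≤ (𝟙 (E a p ∧ E a b)) (pk≤ a))

  walk⇒simplePath : ∀ a rs → Chain (a ∷ rs) → Σ ℕ λ k → SimplePath a (end a rs) k × k ≤ peaks (a ∷ rs)
  walk⇒simplePath a rs ch with loopErasure (suc (length rs)) a rs ≤-refl ch
  ... | ss , ch′ , d′ , e′ , _ , pk≤ =
        peaks (a ∷ ss) , path ss ch′ d′ e′ refl ,
        subst₂ _≤_ (peaks-dup loopless a ss) (peaks-dup loopless a rs) (pk≤ a)

  Chain⇒Linked : ∀ L → Chain L → Linked (UAdj E) L
  Chain⇒Linked [] _ = []
  Chain⇒Linked (x ∷ []) _ = [-]
  Chain⇒Linked (x ∷ y ∷ L) (h , c) = h ∷ Chain⇒Linked (y ∷ L) c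

  meetingPaths⇒cycle : ∀ a X c s Q → Chain (a ∷ X ∷ʳ c) → Distinct (a ∷ X ∷ʳ c) →
    Chain (a ∷ s ∷ Q) → Distinct (a ∷ s ∷ Q) → end s Q ≡ c →
    (∀ v → v ∈ X ∷ʳ c → v ∈ s ∷ Q → v ≡ c) → ¬ (X ≡ [] × Q ≡ []) → UCycle E
  meetingPaths⇒cycle a X c s Q chX dX chQ dQ refl meet nonDegenerate =
    a , xs , length≥3 X Q nonDegenerate , Distinct⇒Unique (a ∷ xs) dCycle ,
    Chain⇒Linked ((a ∷ xs) ∷ʳ a) (subst (λ t → Chain (a ∷ t)) (sym (++-assoc (X ∷ʳ c) back [ a ])) closed)
    where
      back : List V
      back = reversedTail s Q
      xs : List V
      xs = (X ∷ʳ c) ++ back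
      length≥3 : ∀ X Q → ¬ (X ≡ [] × Q ≡ []) → 3 ≤ length (a ∷ (X ∷ʳ c) ++ reversedTail s Q)
      length≥3 (x ∷ []) Q _ = s≤s (s≤s (s≤s z≤n))
      length≥3 (x ∷ x′ ∷ X) Q _ = s≤s (s≤s (s≤s z≤n))
      length≥3 [] (q ∷ Q) _ = s≤s (s≤s (subst (λ l → 1 ≤ l) (sym (length-++ (reversedTail q Q))) (m≤n+m 1 _)))
      length≥3 [] [] nd = ⊥-elim (nd (refl , refl))
      dBack : Distinct (end s Q ∷ back)
      dBack = subst Distinct (reverse-∷ s Q) (Distinct-reverse (s ∷ Q) (proj₂ dQ))
      closed : Chain (a ∷ (X ∷ʳ c) ++ back ∷ʳ a)
      closed = Chain-++ a (X ∷ʳ c) (back ∷ʳ a) chX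
                 (subst (λ t → Chain (t ∷ back ∷ʳ a)) (sym (end-++ a X [ c ]))
                   (subst Chain (reverse-∷ a (s ∷ Q)) (Chain-reverse a (s ∷ Q) chQ)))
      disjoint : Disjoint (X ∷ʳ c) back
      disjoint v p q with meet v p (reversedTail-⊆ s Q q)
      ... | refl = proj₁ dBack q
      dCycle : Distinct (a ∷ xs)
      dCycle = (λ p → [ proj₁ dX , (λ q → proj₁ dQ (reversedTail-⊆ s Q q)) ]′ (∈-++⁻ (X ∷ʳ c) p)) ,
                 Distinct-++ (X ∷ʳ c) back (proj₂ dX) (proj₂ dBack) disjoint

  divergingPaths⇒cycle : ∀ a r rs s ss → Chain (a ∷ r ∷ rs) → Distinct (a ∷ r ∷ rs) →
    Chain (a ∷ s ∷ ss) → Distinct (a ∷ s ∷ ss) → end r rs ≡ end s ss → r ≢ s → UCycle E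
  divergingPaths⇒cycle a r rs s ss chP dP chS dS sameEnd r≢s
    with firstHit (_∈ r ∷ rs) (_∈? r ∷ rs) s ss (subst (_∈ r ∷ rs) sameEnd (end∈ r rs))
  ... | Q₁ , Q₂ , refl , c∈P , first with ∈-∃++ c∈P
  ...   | P₁ , P₂ , eqP =
    meetingPaths⇒cycle a P₁ (end s Q₁) s Q₁
      (Chain-prefix a (P₁ ∷ʳ c) P₂ (subst (λ t → Chain (a ∷ t)) eqP′ chP))
      (Distinct-prefix (a ∷ P₁ ∷ʳ c) P₂ (subst (λ t → Distinct (a ∷ t)) eqP′ dP))
      (Chain-prefix a (s ∷ Q₁) Q₂ chS) (Distinct-prefix (a ∷ s ∷ Q₁) Q₂ dS) refl
      (λ v p q → first v q (subst (_ ∈_) (sym eqP′) (∈-++⁺ˡ p)))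
      (λ { (refl , refl) → r≢s (∷-injectiveˡ eqP) })
    where
      c : V
      c = end s Q₁
      eqP′ : r ∷ rs ≡ (P₁ ∷ʳ c) ++ P₂
      eqP′ = trans eqP (sym (++-assoc P₁ [ c ] P₂))


  leaf∈chain⇒endpoint : ∀ {ℓ} → IsLeaf E ℓ → ∀ a rs → Chain (a ∷ rs) → Distinct (a ∷ rs) → ℓ ∈ a ∷ rs →
                        ℓ ≡ a ⊎ ℓ ≡ end a rs
  leaf∈chain⇒endpoint leaf a rs ch d (here e) = inj₁ e
  leaf∈chain⇒endpoint leaf a (r ∷ rs) (h , ch) (a∉ , d) (there p) with leaf∈chain⇒endpoint leaf r rs ch d p
  ... | inj₂ e = inj₂ e
  ... | inj₁ refl with rs
  ...   | [] = inj₂ refl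
  ...   | r′ ∷ rs′ = ⊥-elim (a∉ (there (here (leaf-uniqueNeighbour leaf (UAdj-sym h) (proj₁ ch)))))

  leaf∈SimplePath⇒endpoint : ∀ {ℓ a b k} → IsLeaf E ℓ → (P : SimplePath a b k) → ℓ ∈ a ∷ steps P → ℓ ≡ a ⊎ ℓ ≡ b
  leaf∈SimplePath⇒endpoint leaf P p with leaf∈chain⇒endpoint leaf _ (steps P) (chain P) (distinct P) p
  ... | inj₁ e = inj₁ e
  ... | inj₂ e = inj₂ (trans e (ends P))

  leaf-notInner : ∀ {a ℓ b k₁ k₂} → IsLeaf E ℓ → (P : SimplePath a ℓ k₁) (Q : SimplePath ℓ b k₂) →
                  Disjoint (a ∷ steps P) (steps Q) → ℓ ≢ a → ℓ ≢ b → ⊥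
  leaf-notInner leaf P Q d ℓ≢a ℓ≢b with leaf∈SimplePath⇒endpoint leaf (SimplePath-++ P Q d) (SimplePath-++-∈ P Q d)
  ... | inj₁ e = ℓ≢a e
  ... | inj₂ e = ℓ≢b e

  Chain-lastStep : ∀ c rs → rs ≢ [] → Chain (c ∷ rs) → UAdj E (penult c rs) (end c rs)
  Chain-lastStep c [] ne _ = ⊥-elim (ne refl)
  Chain-lastStep c (r ∷ []) _ (h , _) = h
  Chain-lastStep c (r ∷ r′ ∷ rs) _ (_ , ch) = Chain-lastStep r (r′ ∷ rs) (λ ()) ch

  arm-peak : ∀ {c l k} (A : SimplePath c l k) → IsLeaf E l → steps A ≢ [] → Arm k (E c (next c (steps A)))
  arm-peak (path [] _ _ _ _) _ ne _ = ⊥-elim (ne refl)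
  arm-peak {c} (path (a ∷ as) ch _ refl refl) leaf ne up =
    up-down⇒peak c (a ∷ as) ch (reverseArc up (proj₁ ch))
      (leaf-neighbour⇒parent leaf (UAdj-sym (Chain-lastStep c (a ∷ as) ne ch)))

  middle-peak : ∀ {c₁ c₂ m} (M : SimplePath c₁ c₂ m) → steps M ≢ [] →
                E c₁ (next c₁ (steps M)) ≡ false → E c₂ (penult c₁ (steps M)) ≡ false → 1 ≤ m
  middle-peak (path [] _ _ _ _) ne _ _ = ⊥-elim (ne refl)
  middle-peak {c₁} (path (a ∷ as) ch _ refl refl) ne up₁ up₂ =
    up-down⇒peak c₁ (a ∷ as) ch (reverseArc up₁ (proj₁ ch))
      (reverseArc up₂ (UAdj-sym (Chain-lastStep c₁ (a ∷ as) ne ch)))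

  joinArms : ∀ {c l₁ l₂ k₁ k₂} (A : SimplePath c l₁ k₁) (B : SimplePath c l₂ k₂) → Disjoint (steps A) (steps B) →
             SimplePath l₁ l₂ (junction k₁ k₂ (E c (next c (steps A))) (E c (next c (steps B))))
  joinArms {c} {k₁ = k₁} {k₂} A B d =
    subst-peaks (cong (λ t → k₁ + k₂ + 𝟙 (E c t ∧ E c (next c (steps B)))) (reverse-penult A))
      (SimplePath-++ (SimplePath-reverse A) B d′)
    where
      d′ : Disjoint (_ ∷ steps (SimplePath-reverse A)) (steps B)
      d′ v p q with reverse-∈ A p
      ... | here refl = proj₁ (distinct B) q
      ... | there p′ = d v p′ q

  joinArms-∈ : ∀ {c l₁ l₂ k₁ k₂} (A : SimplePath c l₁ k₁) (B : SimplePath c l₂ k₂)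
               (d : Disjoint (steps A) (steps B)) {v} →
               v ∈ steps (joinArms A B d) → v ∈ c ∷ steps A ⊎ v ∈ steps B
  joinArms-∈ A B d p with ++-∈⁻ (SimplePath-reverse A) B _ p
  ... | inj₁ q = inj₁ (reverse-∈ A (there q))
  ... | inj₂ q = inj₂ q

  joinArmsVia : ∀ {c₁ c₂ l₁ l₂ k₁ k₂ m} (A : SimplePath c₁ l₁ k₁) (M : SimplePath c₁ c₂ m) (B : SimplePath c₂ l₂ k₂) →
    steps M ≢ [] → Disjoint (c₁ ∷ steps M) (steps B) → Disjoint (steps A) (steps M) → Disjoint (steps A) (steps B) →
    SimplePath l₁ l₂ (leg k₁ (E c₁ (next c₁ (steps A))) (E c₁ (next c₁ (steps M)))
                      + leg k₂ (E c₂ (next c₂ (steps B))) (E c₂ (penult c₁ (steps M))) + m)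
  joinArmsVia {c₁} {c₂} {k₁ = k₁} {k₂} {m} A M B ne dMB dAM dAB = subst-peaks regroup (joinArms A MB dA-MB)
    where
      MB : SimplePath c₁ _ _
      MB = SimplePath-++ M B dMB
      dA-MB : Disjoint (steps A) (steps MB)
      dA-MB v x y = [ dAM v x , dAB v x ]′ (++-∈⁻ M B dMB y)
      rearrange : ∀ a m b i j → a + (m + b + i) + j ≡ (a + j) + (b + i) + m
      rearrange = solve-∀
      regroup : junction k₁ (m + k₂ + 𝟙 (E c₂ (penult c₁ (steps M)) ∧ E c₂ (next c₂ (steps B))))
                  (E c₁ (next c₁ (steps A))) (E c₁ (next c₁ (steps MB)))
                ≡ leg k₁ (E c₁ (next c₁ (steps A))) (E c₁ (next c₁ (steps M)))
                  + leg k₂ (E c₂ (next c₂ (steps B))) (E c₂ (penult c₁ (steps M))) + m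
      regroup = trans (cong₂ (λ a b → k₁ + (m + k₂ + 𝟙 a) + 𝟙 (E c₁ (next c₁ (steps A)) ∧ E c₁ b))
                             (∧-comm (E c₂ (penult c₁ (steps M))) (E c₂ (next c₂ (steps B)))) (++-next M B dMB ne))
                      (rearrange k₁ m k₂ _ _)
module Distances {n : ℕ} {E : Digraph n} (net : IsNetwork E) where
  open IsNetwork net
  open Leaves net
  open Paths net

  𝒜 : Leaf E → Leaf E → Set
  𝒜 = SharedAncestryAdj E

  Ascent : V → V → Set
  Ascent = Star (flip (Arc E))

  ascentVertices : ∀ {x w} → Ascent x w → List V
  ascentVertices ε = []
  ascentVertices (_◅_ {j = v} _ u) = v ∷ ascentVertices u

  descentVertices : ∀ {w y} → DPath E w y → List V
  descentVertices ε = []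
  descentVertices (_◅_ {j = v} _ d) = v ∷ descentVertices d

  Chain-ascent : ∀ x {w} (u : Ascent x w) T → Chain (w ∷ T) → Chain (x ∷ ascentVertices u ++ T)
  Chain-ascent x ε T c = c
  Chain-ascent x (_◅_ {j = v} h u) T c = inj₂ h , Chain-ascent v u T c

  Chain-descent : ∀ w {y} (d : DPath E w y) T → Chain (y ∷ T) → Chain (w ∷ descentVertices d ++ T)
  Chain-descent w ε T c = c
  Chain-descent w (_◅_ {j = v} h d) T c = inj₁ h , Chain-descent v d T c

  end-ascent : ∀ x {w} (u : Ascent x w) T → end x (ascentVertices u ++ T) ≡ end w T
  end-ascent x ε T = refl
  end-ascent x (_◅_ {j = v} h u) T = end-ascent v u T

  end-descent : ∀ w {y} (d : DPath E w y) T → end w (descentVertices d ++ T) ≡ end y T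
  end-descent w ε T = refl
  end-descent w (_◅_ {j = v} h d) T = end-descent v d T

  peaks-ascent : ∀ q x {w} (u : Ascent x w) T → Σ V λ q′ → peaks (q ∷ x ∷ ascentVertices u ++ T) ≡ peaks (q′ ∷ w ∷ T)
  peaks-ascent q x ε T = q , refl
  peaks-ascent q x (_◅_ {j = v} h u) T with peaks-ascent x v u T
  ... | q′ , e = q′ , trans (cong (λ b → 𝟙 (E x q ∧ b) + peaks (x ∷ v ∷ ascentVertices u ++ T))
                                  (arc⇒noReverseArc h)) (trans (cong (_+ _) (cong 𝟙 (∧-zeroʳ (E x q)))) e)

  peaks-descent : ∀ q v {y} (d : DPath E v y) T → Arc E q v → peaks (q ∷ v ∷ descentVertices d ++ T) ≡ peaks (y ∷ T)
  peaks-descent q v ε [] h = refl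
  peaks-descent q v ε (t ∷ T) h = cong (λ b → 𝟙 (b ∧ E v t) + peaksFrom v t T) (arc⇒noReverseArc h)
  peaks-descent q v (_◅_ {j = v′} h′ d) T h =
    trans (cong (λ b → 𝟙 (b ∧ E v v′) + peaks (v ∷ v′ ∷ descentVertices d ++ T)) (arc⇒noReverseArc h))
          (peaks-descent v v′ d T h′)

  peaks-apex : ∀ p w {y} (d : DPath E w y) T → peaks (p ∷ w ∷ descentVertices d ++ T) ≤ 1 + peaks (y ∷ T)
  peaks-apex p w ε [] = z≤n
  peaks-apex p w ε (t ∷ T) = +-monoˡ-≤ (peaksFrom w t T) (𝟙≤1 (E w p ∧ E w t))
  peaks-apex p w (_◅_ {j = v} h d) T =
    ≤-trans (≤-reflexive (cong (𝟙 (E w p ∧ E w v) +_) (peaks-descent w v d T h)))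
            (+-monoˡ-≤ (peaks (_ ∷ T)) (𝟙≤1 (E w p ∧ E w v)))

  -- each step x — y′ of 𝒜 through a common ancestor w becomes the walk up from x to w and down to y′
  𝒜-walk⇒chain : ∀ {x y : Leaf E} {k} → Walk 𝒜 x y k →
                 Σ (List V) λ rs → Chain (proj₁ x ∷ rs) × end (proj₁ x) rs ≡ proj₁ y × peaks (proj₁ x ∷ rs) ≤ k
  𝒜-walk⇒chain here = [] , tt , refl , z≤n
  𝒜-walk⇒chain {x} {y} (step {k = k} (_ , w , dx , dy) rest) with 𝒜-walk⇒chain rest
  ... | T , chT , eT , pkT = L , chL , eL , pkL
    where
      x′ : V
      x′ = proj₁ x
      up : Ascent x′ w
      up = Star-reverse id dx
      L : List V
      L = ascentVertices up ++ descentVertices dy ++ T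
      chL : Chain (x′ ∷ L)
      chL = Chain-ascent x′ up (descentVertices dy ++ T) (Chain-descent w dy T chT)
      eL : end x′ L ≡ proj₁ y
      eL = trans (end-ascent x′ up (descentVertices dy ++ T)) (trans (end-descent w dy T) eT)
      ascended : Σ V λ q′ → peaks (x′ ∷ x′ ∷ L) ≡ peaks (q′ ∷ w ∷ descentVertices dy ++ T)
      ascended = peaks-ascent x′ x′ up (descentVertices dy ++ T)
      pkL : peaks (x′ ∷ L) ≤ suc k
      pkL = ≤-trans (≤-reflexive (trans (sym (peaks-dup loopless x′ L)) (proj₂ ascended)))
              (≤-trans (peaks-apex (proj₁ ascended) w dy T) (s≤s pkT))

  -- Walking along a chain, every peak t is the common ancestor of the leaf ℓ reached so far and a
  -- leaf below the next ascent, so it costs one step of 𝒜.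
  mutual
    ascending⇒𝒜-walk : ∀ (b ℓ : Leaf E) p s W → Chain (s ∷ W) → end s W ≡ proj₁ b →
                       DPath E s (proj₁ ℓ) → Arc E s p → Σ ℕ λ j → j ≤ peaks (p ∷ s ∷ W) × Walk 𝒜 ℓ b j
    ascending⇒𝒜-walk b ℓ p s [] _ refl sℓ _ =
      0 , z≤n , subst (λ t → Walk 𝒜 ℓ t 0) (Leaf-≡ ℓ b (sym (leaf-pathFrom (proj₂ b) sℓ))) here
    ascending⇒𝒜-walk b ℓ p s (s′ ∷ W) (inj₂ h , ch) e sℓ _ with ascending⇒𝒜-walk b ℓ s s′ W ch e (h ◅ sℓ) h
    ... | j , le , wk = j , ≤-trans le (m≤n+m _ _) , wk
    ascending⇒𝒜-walk b ℓ p s (s′ ∷ W) (inj₁ h , ch) e sℓ hp with descending⇒𝒜-walk b ℓ s s s′ W ch e sℓ (h ◅ ε) h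
    ... | j , le , wk =
      j , ≤-trans le (≤-reflexive (trans (+-comm _ 1) (cong (λ i → 𝟙 i + peaks (s ∷ s′ ∷ W)) (sym (cong₂ _∧_ hp h))))) ,
      wk

    descending⇒𝒜-walk : ∀ (b ℓ : Leaf E) t p s W → Chain (s ∷ W) → end s W ≡ proj₁ b →
                        DPath E t (proj₁ ℓ) → DPath E t s → Arc E p s →
                        Σ ℕ λ j → j ≤ peaks (p ∷ s ∷ W) + 1 × Walk 𝒜 ℓ b j
    descending⇒𝒜-walk b ℓ t p s [] _ e tℓ ts _ with proj₁ ℓ ≟ᶠ proj₁ b
    ... | yes ℓ≡b = 0 , z≤n , subst (λ t′ → Walk 𝒜 ℓ t′ 0) (Leaf-≡ ℓ b ℓ≡b) here
    ... | no ℓ≢b = 1 , ≤-refl , step (ℓ≢b , t , tℓ , subst (DPath E t) e ts) here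
    descending⇒𝒜-walk b ℓ t p s (s′ ∷ W) (inj₁ h , ch) e tℓ ts _
      with descending⇒𝒜-walk b ℓ t s s′ W ch e tℓ (ts ◅◅ (h ◅ ε)) h
    ... | j , le , wk = j , ≤-trans le (+-monoˡ-≤ 1 (m≤n+m _ _)) , wk
    descending⇒𝒜-walk b ℓ t p s (s′ ∷ W) (inj₂ h , ch) e tℓ ts _ with leafBelow s
    ... | l′ , lf′ , sl′ with ascending⇒𝒜-walk b (l′ , lf′) s s′ W ch e (h ◅ sl′) h
    ...   | j , le , wk with proj₁ ℓ ≟ᶠ l′
    ...     | yes ℓ≡l′ = j , ≤-trans le (≤-trans (m≤n+m _ _) (m≤m+n _ 1)) ,
                         subst (λ t′ → Walk 𝒜 t′ b j) (sym (Leaf-≡ ℓ (l′ , lf′) ℓ≡l′)) wk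
    ...     | no ℓ≢l′ = suc j , ≤-trans (s≤s le) (≤-trans (s≤s (m≤n+m _ _)) (≤-reflexive (+-comm 1 _))) ,
                        step (ℓ≢l′ , t , tℓ , ts ◅◅ sl′) wk

  chain⇒𝒜-walk : ∀ (x y : Leaf E) rs → Chain (proj₁ x ∷ rs) → end (proj₁ x) rs ≡ proj₁ y →
                 Σ ℕ λ j → j ≤ peaks (proj₁ x ∷ rs) × Walk 𝒜 x y j
  chain⇒𝒜-walk x y [] _ e = 0 , z≤n , subst (λ t → Walk 𝒜 x t 0) (Leaf-≡ x y e) here
  chain⇒𝒜-walk x y (s ∷ W) (h , ch) e = ascending⇒𝒜-walk y x (proj₁ x) s W ch e (parent ◅ ε) parent
    where
      parent : Arc E s (proj₁ x)
      parent = leaf-neighbour⇒parent (proj₂ x) h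

  𝒜-sym : ∀ {x y} → 𝒜 x y → 𝒜 y x
  𝒜-sym (x≢y , w , wx , wy) = ≢-sym x≢y , w , wy , wx

  Walk-∷ʳ : ∀ {a b c k} → Walk 𝒜 a b k → 𝒜 b c → Walk 𝒜 a c (suc k)
  Walk-∷ʳ here h = step h here
  Walk-∷ʳ (step h′ w) h = step h′ (Walk-∷ʳ w h)

  Walk-reverse : ∀ {a b k} → Walk 𝒜 a b k → Walk 𝒜 b a k
  Walk-reverse here = here
  Walk-reverse {a} (step {y = m} h w) = Walk-∷ʳ (Walk-reverse w) (𝒜-sym {a} {m} h)

  IsDist-sym : ∀ {x y k} → IsDist 𝒜 x y k → IsDist 𝒜 y x k
  IsDist-sym (w , shortest) = Walk-reverse w , λ m w′ → shortest m (Walk-reverse w′)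

  IsDist-unique : ∀ {x y : Leaf E} {k k′} → IsDist 𝒜 x y k → IsDist 𝒜 x y k′ → k ≡ k′
  IsDist-unique (w , shortest) (w′ , shortest′) = ≤-antisym (shortest _ w′) (shortest′ _ w)

  IsDist-refl⇒0 : ∀ {p k} → IsDist 𝒜 p p k → k ≡ 0
  IsDist-refl⇒0 (_ , shortest) = n≤0⇒n≡0 (shortest 0 here)

+≡⇒≤ : ∀ {x y} k → x + k ≡ y → x ≤ y
+≡⇒≤ {x} k refl = m≤m+n x k

Triangle : ℕ → ℕ → ℕ → Set
Triangle A B C = A ≤ B + C × B ≤ A + C × C ≤ A + B

Triangle-cong : ∀ {A B C A′ B′ C′} → A ≡ A′ → B ≡ B′ → C ≡ C′ → Triangle A B C → Triangle A′ B′ C′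
Triangle-cong refl refl refl t = t

Triangle-swap₁₂ : ∀ {A B C} → Triangle A B C → Triangle B A C
Triangle-swap₁₂ {A} {B} {C} (a , b , c) = b , a , subst (C ≤_) (+-comm A B) c

Triangle-swap₂₃ : ∀ {A B C} → Triangle A B C → Triangle A C B
Triangle-swap₂₃ {A} {B} {C} (a , b , c) = subst (A ≤_) (+-comm B C) a , c , b

-- (p + r + m)(q + s + m) − (p + s + m)(q + r + m) = (p − q)(r − s), and |p − q| ≤ D₁, |r − s| ≤ D₂.
ptolemy-cross : ∀ p q r s m D₁ D₂ → p ≤ q + D₁ → q ≤ p + D₁ → r ≤ s + D₂ → s ≤ r + D₂ →
                (p + r + m) * (q + s + m) ≤ D₁ * D₂ + (p + s + m) * (q + r + m)
ptolemy-cross p q r s m D₁ D₂ pq qp rs sr with ≤-total p q | ≤-total r s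
... | inj₁ p≤q | inj₁ r≤s with m≤n⇒∃[o]m+o≡n p≤q | m≤n⇒∃[o]m+o≡n r≤s
...   | t , refl | u , refl = ≤-trans (+≡⇒≤ (u * t) (sym (identity p r m t u))) (m≤n+m _ (D₁ * D₂))
  where
    identity : ∀ p r m t u → (p + (r + u) + m) * ((p + t) + r + m) ≡ (p + r + m) * ((p + t) + (r + u) + m) + u * t
    identity = solve-∀
ptolemy-cross p q r s m D₁ D₂ pq qp rs sr | inj₁ p≤q | inj₂ s≤r with m≤n⇒∃[o]m+o≡n p≤q | m≤n⇒∃[o]m+o≡n s≤r
...   | t , refl | u , refl =
  ≤-trans (≤-reflexive (identity p s m t u))
    (≤-trans (+-monoʳ-≤ _ (*-mono-≤ (+-cancelˡ-≤ s u D₂ rs) (+-cancelˡ-≤ p t D₁ qp)))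
      (≤-reflexive (trans (+-comm _ (D₂ * D₁)) (cong (_+ (p + s + m) * (p + t + (s + u) + m)) (*-comm D₂ D₁)))))
  where
    identity : ∀ p s m t u → (p + (s + u) + m) * ((p + t) + s + m) ≡ (p + s + m) * ((p + t) + (s + u) + m) + u * t
    identity = solve-∀
ptolemy-cross p q r s m D₁ D₂ pq qp rs sr | inj₂ q≤p | inj₁ r≤s with m≤n⇒∃[o]m+o≡n q≤p | m≤n⇒∃[o]m+o≡n r≤s
...   | t , refl | u , refl =
  ≤-trans (≤-reflexive (identity q r m t u))
    (≤-trans (+-monoʳ-≤ _ (*-mono-≤ (+-cancelˡ-≤ q t D₁ pq) (+-cancelˡ-≤ r u D₂ sr))) (≤-reflexive (+-comm _ (D₁ * D₂))))
  where
    identity : ∀ q r m t u → ((q + t) + r + m) * (q + (r + u) + m) ≡ ((q + t) + (r + u) + m) * (q + r + m) + t * u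
    identity = solve-∀
ptolemy-cross p q r s m D₁ D₂ pq qp rs sr | inj₂ q≤p | inj₂ s≤r with m≤n⇒∃[o]m+o≡n q≤p | m≤n⇒∃[o]m+o≡n s≤r
...   | t , refl | u , refl = ≤-trans (+≡⇒≤ (t * u) (sym (identity q s m t u))) (m≤n+m _ (D₁ * D₂))
  where
    identity : ∀ q s m t u → ((q + t) + s + m) * (q + (s + u) + m) ≡ ((q + t) + (s + u) + m) * (q + s + m) + t * u
    identity = solve-∀

ptolemy-diagonal : ∀ p q r s m D₁ D₂ → D₁ ≤ p + q + m → D₂ ≤ r + s + m →
                   D₁ * D₂ ≤ (p + r + m) * (q + s + m) + (p + s + m) * (q + r + m)
ptolemy-diagonal p q r s m D₁ D₂ h₁ h₂ = ≤-trans (*-mono-≤ h₁ h₂) (+≡⇒≤ _ (identity p q r s m))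
  where
    identity : ∀ p q r s m → (p + q + m) * (r + s + m) + (2 * p * q + 2 * r * s + m * (p + q + r + s) + m * m)
               ≡ (p + r + m) * (q + s + m) + (p + s + m) * (q + r + m)
    identity = solve-∀

ptolemy-diagonal-+1ˡ : ∀ p q r s D₁ D₂ → 1 ≤ r → 1 ≤ s → D₁ ≤ p + q + 1 → D₂ ≤ r + s + 0 →
                       D₁ * D₂ ≤ (p + r + 0) * (q + s + 0) + (p + s + 0) * (q + r + 0)
ptolemy-diagonal-+1ˡ p q (suc r) (suc s) D₁ D₂ _ _ h₁ h₂ =
  ≤-trans (*-mono-≤ h₁ (≤-trans h₂ (≤-reflexive (+-identityʳ _)))) (+≡⇒≤ _ (identity p q r s))
  where
    identity : ∀ p q r s → (p + q + 1) * (suc r + suc s) + (2 * p * q + 2 * r * s + r + s)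
               ≡ (p + suc r + 0) * (q + suc s + 0) + (p + suc s + 0) * (q + suc r + 0)
    identity = solve-∀

ptolemy-diagonal-+1ʳ : ∀ p q r s D₁ D₂ → 1 ≤ p → 1 ≤ q → D₁ ≤ p + q + 0 → D₂ ≤ r + s + 1 →
                       D₁ * D₂ ≤ (p + r + 0) * (q + s + 0) + (p + s + 0) * (q + r + 0)
ptolemy-diagonal-+1ʳ (suc p) (suc q) r s D₁ D₂ _ _ h₁ h₂ =
  ≤-trans (*-mono-≤ (≤-trans h₁ (≤-reflexive (+-identityʳ _))) h₂) (+≡⇒≤ _ (identity p q r s))
  where
    identity : ∀ p q r s → (suc p + suc q) * (r + s + 1) + (2 * r * s + 2 * p * q + p + q)
               ≡ (suc p + r + 0) * (suc q + s + 0) + (suc p + s + 0) * (suc q + r + 0)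
    identity = solve-∀

junction-comm : ∀ a b e e′ → junction a b e e′ ≡ junction b a e′ e
junction-comm a b e e′ = cong₂ _+_ (+-comm a b) (cong 𝟙 (∧-comm e e′))

m+0≤o+[m+n+p] : ∀ m n o p → m + 0 ≤ o + (m + n + p)
m+0≤o+[m+n+p] m n o p =
  ≤-trans (≤-reflexive (+-identityʳ m)) (≤-trans (≤-trans (m≤m+n m n) (m≤m+n (m + n) p)) (m≤n+m _ o))

leg≤leg+junction : ∀ a b ea eb f → Arm b eb → leg a ea f ≤ leg b eb f + junction a b ea eb
leg≤leg+junction a b false eb f _ = m+0≤o+[m+n+p] a b (leg b eb f) (𝟙 (false ∧ eb))
leg≤leg+junction a b true eb false _ = m+0≤o+[m+n+p] a b (leg b eb false) (𝟙 (true ∧ eb))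
leg≤leg+junction a b true true true _ = +≡⇒≤ _ (identity a b)
  where
    identity : ∀ a b → a + 1 + (b + b + 1) ≡ (b + 1) + (a + b + 1)
    identity = solve-∀
leg≤leg+junction a zero true false true hb = contradiction (hb refl) λ ()
leg≤leg+junction a (suc b) true false true _ = +≡⇒≤ _ (identity a b)
  where
    identity : ∀ a b → a + 1 + (b + b + 1) ≡ (suc b + 0) + (a + suc b + 0)
    identity = solve-∀

leg≤leg+junction′ : ∀ a b ea eb f → Arm a ea → leg b eb f ≤ leg a ea f + junction a b ea eb
leg≤leg+junction′ a b ea eb f ha =
  subst (λ t → leg b eb f ≤ leg a ea f + t) (junction-comm b a eb ea) (leg≤leg+junction b a eb ea f ha)

junction≤legs : ∀ a b ea eb → junction a b ea eb ≤ leg a ea true + leg b eb true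
junction≤legs a b true true = +≡⇒≤ 1 (identity a b)
  where
    identity : ∀ a b → a + b + 1 + 1 ≡ (a + 1) + (b + 1)
    identity = solve-∀
junction≤legs a b true false = +≡⇒≤ 1 (identity a b)
  where
    identity : ∀ a b → a + b + 0 + 1 ≡ (a + 1) + (b + 0)
    identity = solve-∀
junction≤legs a b false true = +≡⇒≤ 1 (identity a b)
  where
    identity : ∀ a b → a + b + 0 + 1 ≡ (a + 0) + (b + 1)
    identity = solve-∀
junction≤legs a b false false = +≡⇒≤ 0 (identity a b)
  where
    identity : ∀ a b → a + b + 0 + 0 ≡ (a + 0) + (b + 0)
    identity = solve-∀

junction≤legs+1 : ∀ a b ea eb f → junction a b ea eb ≤ leg a ea f + leg b eb f + 1
junction≤legs+1 a b ea eb f = ≤-trans (+-monoʳ-≤ (a + b) (𝟙≤1 (ea ∧ eb)))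
                                (+-monoˡ-≤ 1 (+-mono-≤ (m≤m+n a _) (m≤m+n b _)))

leg-positive : ∀ a e → Arm a e → 1 ≤ leg a e true
leg-positive a true _ = m≤n+m 1 a
leg-positive a false h = ≤-trans (h refl) (m≤m+n a 0)

-- Four arms, p and q at one centre and r and s at the other, joined by a middle path with m peaks
-- whose end arcs point away from the centres iff f₁ resp. f₂.
TwoCentres : ∀ (ap aq ar as m : ℕ) (ep eq er es f₁ f₂ : Bool) → Set
TwoCentres ap aq ar as m ep eq er es f₁ f₂ =
  Triangle (junction ap aq ep eq * junction ar as er es)
           ((leg ap ep f₁ + leg ar er f₂ + m) * (leg aq eq f₁ + leg as es f₂ + m))
           ((leg ap ep f₁ + leg as es f₂ + m) * (leg aq eq f₁ + leg ar er f₂ + m))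

twoCentres-diagonal : ∀ ap aq ar as m ep eq er es f₁ f₂ → Arm ap ep → Arm aq eq → Arm ar er → Arm as es →
  (f₁ ≡ false → f₂ ≡ false → 1 ≤ m) →
  junction ap aq ep eq * junction ar as er es ≤
    (leg ap ep f₁ + leg ar er f₂ + m) * (leg aq eq f₁ + leg as es f₂ + m) +
    (leg ap ep f₁ + leg as es f₂ + m) * (leg aq eq f₁ + leg ar er f₂ + m)
twoCentres-diagonal ap aq ar as (suc m) ep eq er es f₁ f₂ _ _ _ _ _ =
  ptolemy-diagonal (leg ap ep f₁) (leg aq eq f₁) (leg ar er f₂) (leg as es f₂) (suc m) _ _
    (≤-trans (junction≤legs+1 ap aq ep eq f₁) (+-monoʳ-≤ _ (s≤s z≤n)))
    (≤-trans (junction≤legs+1 ar as er es f₂) (+-monoʳ-≤ _ (s≤s z≤n)))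
twoCentres-diagonal ap aq ar as zero ep eq er es true true _ _ _ _ _ =
  ptolemy-diagonal (leg ap ep true) (leg aq eq true) (leg ar er true) (leg as es true) 0 _ _
    (≤-trans (junction≤legs ap aq ep eq) (m≤m+n _ 0)) (≤-trans (junction≤legs ar as er es) (m≤m+n _ 0))
twoCentres-diagonal ap aq ar as zero ep eq er es true false hp hq _ _ _ =
  ptolemy-diagonal-+1ʳ (leg ap ep true) (leg aq eq true) (leg ar er false) (leg as es false) _ _
    (leg-positive ap ep hp) (leg-positive aq eq hq) (≤-trans (junction≤legs ap aq ep eq) (m≤m+n _ 0))
    (junction≤legs+1 ar as er es false)
twoCentres-diagonal ap aq ar as zero ep eq er es false true _ _ hr hs _ =
  ptolemy-diagonal-+1ˡ (leg ap ep false) (leg aq eq false) (leg ar er true) (leg as es true) _ _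
    (leg-positive ar er hr) (leg-positive as es hs) (junction≤legs+1 ap aq ep eq false)
    (≤-trans (junction≤legs ar as er es) (m≤m+n _ 0))
twoCentres-diagonal ap aq ar as zero ep eq er es false false _ _ _ _ hm = contradiction (hm refl refl) λ ()

twoCentres-triangle : ∀ ap aq ar as m ep eq er es f₁ f₂ → Arm ap ep → Arm aq eq → Arm ar er → Arm as es →
  (f₁ ≡ false → f₂ ≡ false → 1 ≤ m) → TwoCentres ap aq ar as m ep eq er es f₁ f₂
twoCentres-triangle ap aq ar as m ep eq er es f₁ f₂ hp hq hr hs hm =
  twoCentres-diagonal ap aq ar as m ep eq er es f₁ f₂ hp hq hr hs hm ,
  ptolemy-cross (leg ap ep f₁) (leg aq eq f₁) (leg ar er f₂) (leg as es f₂) m _ _ pq qp rs sr ,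
  ptolemy-cross (leg ap ep f₁) (leg aq eq f₁) (leg as es f₂) (leg ar er f₂) m _ _ pq qp sr rs
  where
    pq : leg ap ep f₁ ≤ leg aq eq f₁ + junction ap aq ep eq
    pq = leg≤leg+junction ap aq ep eq f₁ hq
    qp : leg aq eq f₁ ≤ leg ap ep f₁ + junction ap aq ep eq
    qp = leg≤leg+junction′ ap aq ep eq f₁ hp
    rs : leg ar er f₂ ≤ leg as es f₂ + junction ar as er es
    rs = leg≤leg+junction ar as er es f₂ hs
    sr : leg as es f₂ ≤ leg ar er f₂ + junction ar as er es
    sr = leg≤leg+junction′ ar as er es f₂ hr

StarShape : ∀ (ap aq ar as : ℕ) (ep eq er es : Bool) → Set
StarShape ap aq ar as ep eq er es =
  Triangle (junction ap aq ep eq * junction ar as er es) (junction ap ar ep er * junction aq as eq es)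
           (junction ap as ep es * junction aq ar eq er)

legs≡junction : ∀ a b e e′ → leg a e (not e) + leg b e′ e + 0 ≡ junction a b e e′
legs≡junction a b true true = identity a b
  where
    identity : ∀ a b → (a + 0) + (b + 1) + 0 ≡ a + b + 1
    identity = solve-∀
legs≡junction a b true false = identity a b
  where
    identity : ∀ a b → (a + 0) + (b + 0) + 0 ≡ a + b + 0
    identity = solve-∀
legs≡junction a b false true = identity a b
  where
    identity : ∀ a b → (a + 0) + (b + 0) + 0 ≡ a + b + 0
    identity = solve-∀
legs≡junction a b false false = identity a b
  where
    identity : ∀ a b → (a + 0) + (b + 0) + 0 ≡ a + b + 0
    identity = solve-∀

-- When p and q leave the centre in the same direction e, the star is the two-centre configuration
-- with an empty middle path whose end arcs are oriented by not e and e.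
star-sameDirection₁₂ : ∀ ap aq ar as e er es → Arm ap e → Arm aq e → Arm ar er → Arm as es →
                     StarShape ap aq ar as e e er es
star-sameDirection₁₂ ap aq ar as e er es hp hq hr hs =
  Triangle-cong refl (cong₂ _*_ (legs≡junction ap ar e er) (legs≡junction aq as e es))
                     (cong₂ _*_ (legs≡junction ap as e es) (legs≡junction aq ar e er))
    (twoCentres-triangle ap aq ar as 0 e e er es (not e) e hp hq hr hs (emptyMiddle e))
  where
    emptyMiddle : ∀ e → not e ≡ false → e ≡ false → 1 ≤ 0
    emptyMiddle true _ ()
    emptyMiddle false () _

star-sameDirection₃₄ : ∀ ap aq ar as ep eq e → Arm ap ep → Arm aq eq → Arm ar e → Arm as e →
                       StarShape ap aq ar as ep eq e e
star-sameDirection₃₄ ap aq ar as ep eq e hp hq hr hs =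
  Triangle-cong (*-comm (junction ar as e e) (junction ap aq ep eq))
                (cong₂ _*_ (junction-comm ar ap e ep) (junction-comm as aq e eq))
                (trans (*-comm (junction ar aq e eq) (junction as ap e ep))
                       (cong₂ _*_ (junction-comm as ap e ep) (junction-comm ar aq e eq)))
    (star-sameDirection₁₂ ar as ap aq e ep eq hr hs hp hq)
star-sameDirection₁₃ : ∀ ap aq ar as ep eq → Arm ap ep → Arm aq eq → Arm ar ep → Arm as eq →
                       StarShape ap aq ar as ep eq ep eq
star-sameDirection₁₃ ap aq ar as ep eq hp hq hr hs =
  Triangle-cong refl refl (cong (junction ap as ep eq *_) (junction-comm ar aq ep eq))
    (Triangle-swap₁₂ (star-sameDirection₁₂ ap ar aq as ep eq eq hp hr hq hs))
star-sameDirection₁₄ : ∀ ap aq ar as ep eq → Arm ap ep → Arm aq eq → Arm ar eq → Arm as ep →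
                       StarShape ap aq ar as ep eq eq ep
star-sameDirection₁₄ ap aq ar as ep eq hp hq hr hs =
  Triangle-cong (cong (junction ap aq ep eq *_) (junction-comm as ar ep eq))
                (cong (junction ap ar ep eq *_) (junction-comm as aq ep eq)) refl
    (Triangle-swap₂₃ (Triangle-swap₁₂ (star-sameDirection₁₂ ap as aq ar ep eq eq hp hs hq hr)))

star-triangle : ∀ ap aq ar as ep eq er es → Arm ap ep → Arm aq eq → Arm ar er → Arm as es →
                StarShape ap aq ar as ep eq er es
star-triangle ap aq ar as true true er es = star-sameDirection₁₂ ap aq ar as true er es
star-triangle ap aq ar as false false er es = star-sameDirection₁₂ ap aq ar as false er es
star-triangle ap aq ar as true false true true = star-sameDirection₃₄ ap aq ar as true false true
star-triangle ap aq ar as true false false false = star-sameDirection₃₄ ap aq ar as true false false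
star-triangle ap aq ar as false true true true = star-sameDirection₃₄ ap aq ar as false true true
star-triangle ap aq ar as false true false false = star-sameDirection₃₄ ap aq ar as false true false
star-triangle ap aq ar as true false true false = star-sameDirection₁₃ ap aq ar as true false
star-triangle ap aq ar as false true false true = star-sameDirection₁₃ ap aq ar as false true
star-triangle ap aq ar as true false false true = star-sameDirection₁₄ ap aq ar as true false
star-triangle ap aq ar as false true true false = star-sameDirection₁₄ ap aq ar as false true

module Tree {n : ℕ} {E : Digraph n} (net : IsNetwork E) (arb : Arboreal E) where
  open IsNetwork net
  open Leaves net
  open Paths net
  open Distances net
  open DecMembership (_≟ᶠ_ {n}) using (_∈?_)

  simplePath-unique : ∀ a rs ss → Chain (a ∷ rs) → Distinct (a ∷ rs) → Chain (a ∷ ss) → Distinct (a ∷ ss) →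
                      end a rs ≡ end a ss → rs ≡ ss
  simplePath-unique a [] [] _ _ _ _ _ = refl
  simplePath-unique a [] (s ∷ ss) _ _ _ d₂ e = ⊥-elim (proj₁ d₂ (subst (_∈ s ∷ ss) (sym e) (end∈ s ss)))
  simplePath-unique a (r ∷ rs) [] _ d₁ _ _ e = ⊥-elim (proj₁ d₁ (subst (_∈ r ∷ rs) e (end∈ r rs)))
  simplePath-unique a (r ∷ rs) (s ∷ ss) c₁ d₁ c₂ d₂ e with r ≟ᶠ s
  ... | yes refl = cong (r ∷_) (simplePath-unique r rs ss (proj₂ c₁) (proj₂ d₁) (proj₂ c₂) (proj₂ d₂) e)
  ... | no r≢s = ⊥-elim (proj₂ arb (divergingPaths⇒cycle a r rs s ss c₁ d₁ c₂ d₂ e r≢s))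

  SimplePath-peaks-unique : ∀ {a b k k′} → SimplePath a b k → SimplePath a b k′ → k ≡ k′
  SimplePath-peaks-unique {a} (path rs c d e refl) (path rs′ c′ d′ e′ refl) =
    cong (λ t → peaks (a ∷ t)) (simplePath-unique a rs rs′ c d c′ d′ (trans e (sym e′)))

  simplePath : ∀ a b → Σ ℕ λ k → SimplePath a b k
  simplePath a b with toChain (proj₁ arb a b)
    where
      toChain : ∀ {a b} → Star (UAdj E) a b → Σ (List V) λ rs → Chain (a ∷ rs) × end a rs ≡ b
      toChain ε = [] , tt , refl
      toChain (_◅_ {j = v} h st) with toChain st
      ... | rs , c , e = v ∷ rs , (h , c) , e
  ... | rs , c , refl with walk⇒simplePath a rs c
  ...   | k , P , _ = k , P

  simplePath⇒IsDist : ∀ (x y : Leaf E) {k} → SimplePath (proj₁ x) (proj₁ y) k → IsDist 𝒜 x y k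
  simplePath⇒IsDist x y {k} P@(path rs c _ e refl) = subst (Walk 𝒜 x y) (≤-antisym j≤k (shortest j walk)) walk , shortest
    where
      shortest : ∀ m → Walk 𝒜 x y m → k ≤ m
      shortest m wk with 𝒜-walk⇒chain wk
      ... | rs′ , c′ , refl , pk≤m with walk⇒simplePath (proj₁ x) rs′ c′
      ...   | k′ , P′ , k′≤ = ≤-trans (≤-reflexive (SimplePath-peaks-unique P P′)) (≤-trans k′≤ pk≤m)
      lifted : Σ ℕ λ j → j ≤ peaks (proj₁ x ∷ rs) × Walk 𝒜 x y j
      lifted = chain⇒𝒜-walk x y rs c e
      j : ℕ
      j = proj₁ lifted
      j≤k : j ≤ k
      j≤k = proj₁ (proj₂ lifted)
      walk : Walk 𝒜 x y j
      walk = proj₂ (proj₂ lifted)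

  𝒜-connected : Connected 𝒜
  𝒜-connected x y with simplePath (proj₁ x) (proj₁ y)
  ... | k , P = k , proj₁ (simplePath⇒IsDist x y P)

  Ptolemy₄ : Leaf E → Leaf E → Leaf E → Leaf E → Set
  Ptolemy₄ p q r s = ∀ {pq rs pr qs ps qr} → IsDist 𝒜 p q pq → IsDist 𝒜 r s rs → IsDist 𝒜 p r pr →
                     IsDist 𝒜 q s qs → IsDist 𝒜 p s ps → IsDist 𝒜 q r qr → Triangle (pq * rs) (pr * qs) (ps * qr)

  Ptolemy₄-swap₁₂ : ∀ {p q r s} → Ptolemy₄ p q r s → Ptolemy₄ q p r s
  Ptolemy₄-swap₁₂ P {d₁} {d₂} {d₃} {d₄} {d₅} {d₆} qp rs qr ps qs pr =
    Triangle-cong refl (*-comm d₄ d₃) (*-comm d₆ d₅) (Triangle-swap₂₃ (P (IsDist-sym qp) rs pr qs ps qr))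

  Ptolemy₄-swapPairs : ∀ {p q r s} → Ptolemy₄ p q r s → Ptolemy₄ r s p q
  Ptolemy₄-swapPairs P {d₁} {d₂} {d₃} {d₄} {d₅} {d₆} rs pq rp sq rq sp =
    Triangle-cong (*-comm d₂ d₁) refl (*-comm d₆ d₅)
      (P pq rs (IsDist-sym rp) (IsDist-sym sq) (IsDist-sym sp) (IsDist-sym rq))

  Ptolemy₄-swap₂₃ : ∀ {p q r s} → Ptolemy₄ p q r s → Ptolemy₄ p r q s
  Ptolemy₄-swap₂₃ P pr qs pq rs ps rq = Triangle-swap₁₂ (P pq rs pr qs ps (IsDist-sym rq))

  Ptolemy₄-swap₃₄ : ∀ {p q r s} → Ptolemy₄ p q r s → Ptolemy₄ p q s r
  Ptolemy₄-swap₃₄ P = Ptolemy₄-swapPairs (Ptolemy₄-swap₁₂ (Ptolemy₄-swapPairs P))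

  Ptolemy₄-coincident : ∀ p r s → Ptolemy₄ p p r s
  Ptolemy₄-coincident p r s {d₁} {d₂} {d₃} {d₄} {d₅} {d₆} pp rs pr ps ps′ pr′
    rewrite IsDist-refl⇒0 pp | IsDist-unique pr′ pr | IsDist-unique ps′ ps =
    z≤n , ≤-reflexive (*-comm d₃ d₄) , ≤-reflexive (*-comm d₄ d₃)

  Ptolemy₄-fromPaths : ∀ {p q r s : Leaf E} {kpq krs kpr kqs kps kqr} →
    SimplePath (proj₁ p) (proj₁ q) kpq → SimplePath (proj₁ r) (proj₁ s) krs →
    SimplePath (proj₁ p) (proj₁ r) kpr → SimplePath (proj₁ q) (proj₁ s) kqs →
    SimplePath (proj₁ p) (proj₁ s) kps → SimplePath (proj₁ q) (proj₁ r) kqr →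
    Triangle (kpq * krs) (kpr * kqs) (kps * kqr) → Ptolemy₄ p q r s
  Ptolemy₄-fromPaths Ppq Prs Ppr Pqs Pps Pqr triangle pq rs pr qs ps qr =
    Triangle-cong (cong₂ _*_ (dist≡ pq Ppq) (dist≡ rs Prs)) (cong₂ _*_ (dist≡ pr Ppr) (dist≡ qs Pqs))
                  (cong₂ _*_ (dist≡ ps Pps) (dist≡ qr Pqr)) triangle
    where
      dist≡ : ∀ {x y d k} → IsDist 𝒜 x y d → SimplePath (proj₁ x) (proj₁ y) k → k ≡ d
      dist≡ {x} {y} dxy P = IsDist-unique (simplePath⇒IsDist x y P) dxy

  twoCentres-ptolemy : ∀ (p q r s : Leaf E) (c₁ c₂ : V) {ap aq ar as m}
    (Ap : SimplePath c₁ (proj₁ p) ap) (Aq : SimplePath c₁ (proj₁ q) aq) (M : SimplePath c₁ c₂ m)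
    (Ar : SimplePath c₂ (proj₁ r) ar) (As : SimplePath c₂ (proj₁ s) as) →
    steps Ap ≢ [] → steps Aq ≢ [] → steps M ≢ [] → steps Ar ≢ [] → steps As ≢ [] →
    Disjoint (steps Ap) (steps Aq) → Disjoint (steps Ar) (steps As) →
    Disjoint (steps Ap) (steps M) → Disjoint (steps Aq) (steps M) →
    Disjoint (steps Ap) (steps Ar) → Disjoint (steps Ap) (steps As) →
    Disjoint (steps Aq) (steps Ar) → Disjoint (steps Aq) (steps As) →
    Disjoint (c₁ ∷ steps M) (steps Ar) → Disjoint (c₁ ∷ steps M) (steps As) → Ptolemy₄ p q r s
  twoCentres-ptolemy p q r s c₁ c₂ {ap} {aq} {ar} {as} {m} Ap Aq M Ar As nP nQ nM nR nS
                     dPQ dRS dPM dQM dPR dPS dQR dQS dMR dMS =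
    Ptolemy₄-fromPaths (joinArms Ap Aq dPQ) (joinArms Ar As dRS)
      (joinArmsVia Ap M Ar nM dMR dPM dPR) (joinArmsVia Aq M As nM dMS dQM dQS)
      (joinArmsVia Ap M As nM dMS dPM dPS) (joinArmsVia Aq M Ar nM dMR dQM dQR)
      (twoCentres-triangle ap aq ar as m _ _ _ _ _ _
        (arm-peak Ap (proj₂ p) nP) (arm-peak Aq (proj₂ q) nQ) (arm-peak Ar (proj₂ r) nR) (arm-peak As (proj₂ s) nS)
        (middle-peak M nM))

  star-ptolemy : ∀ (p q r s : Leaf E) (c : V) {ap aq ar as}
    (Ap : SimplePath c (proj₁ p) ap) (Aq : SimplePath c (proj₁ q) aq)
    (Ar : SimplePath c (proj₁ r) ar) (As : SimplePath c (proj₁ s) as) →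
    steps Ap ≢ [] → steps Aq ≢ [] → steps Ar ≢ [] → steps As ≢ [] →
    Disjoint (steps Ap) (steps Aq) → Disjoint (steps Ar) (steps As) → Disjoint (steps Ap) (steps Ar) →
    Disjoint (steps Ap) (steps As) → Disjoint (steps Aq) (steps Ar) → Disjoint (steps Aq) (steps As) →
    Ptolemy₄ p q r s
  star-ptolemy p q r s c {ap} {aq} {ar} {as} Ap Aq Ar As nP nQ nR nS dPQ dRS dPR dPS dQR dQS =
    Ptolemy₄-fromPaths (joinArms Ap Aq dPQ) (joinArms Ar As dRS) (joinArms Ap Ar dPR) (joinArms Aq As dQS)
      (joinArms Ap As dPS) (joinArms Aq Ar dQR)
      (star-triangle ap aq ar as _ _ _ _
        (arm-peak Ap (proj₂ p) nP) (arm-peak Aq (proj₂ q) nQ) (arm-peak Ar (proj₂ r) nR) (arm-peak As (proj₂ s) nS))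

  record Median (x y z : Leaf E) : Set where
    constructor median
    field
      centre : V
      kx ky kz : ℕ
      armX : SimplePath centre (proj₁ x) kx
      armY : SimplePath centre (proj₁ y) ky
      armZ : SimplePath centre (proj₁ z) kz
      nonemptyX : steps armX ≢ []
      nonemptyY : steps armY ≢ []
      nonemptyZ : steps armZ ≢ []
      disjointXY : Disjoint (steps armX) (steps armY)
      disjointXZ : Disjoint (steps armX) (steps armZ)
      disjointYZ : Disjoint (steps armY) (steps armZ)

  median-fromHit : ∀ (x y z : Leaf E) → proj₁ x ≢ proj₁ y → proj₁ x ≢ proj₁ z → proj₁ y ≢ proj₁ z →
    ∀ {m kP kZ} (P : SimplePath (proj₁ x) (proj₁ y) kP) (Pz : SimplePath (proj₁ z) m kZ) → m ∈ proj₁ x ∷ steps P →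
    (∀ v → v ∈ proj₁ z ∷ steps Pz → v ∈ proj₁ x ∷ steps P → v ≡ m) → Median x y z
  median-fromHit x y z x≢y x≢z y≢z {m} P Pz m∈P first =
    median m _ _ _ AX AY AZ (SimplePath-nonempty AX m≢x) (SimplePath-nonempty AY m≢y) (SimplePath-nonempty AZ m≢z)
      dXY dXZ dYZ
    where
      S : Split P m
      S = splitAt P m∈P
      open Split S
      AX : SimplePath m (proj₁ x) _
      AX = SimplePath-reverse front
      AY : SimplePath m (proj₁ y) _
      AY = back
      AZ : SimplePath m (proj₁ z) _
      AZ = SimplePath-reverse Pz
      AX⊆P : ∀ {v} → v ∈ steps AX → v ∈ proj₁ x ∷ steps P
      AX⊆P p with reverse-∈ front (there p)
      ... | here e = here e
      ... | there q = there (front⊆ q)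
      AZ⊆Pz : ∀ {v} → v ∈ steps AZ → v ∈ proj₁ z ∷ steps Pz
      AZ⊆Pz p = reverse-∈ Pz (there p)
      dXY : Disjoint (steps AX) (steps AY)
      dXY v p q = front#back v (reverse-∈ front (there p)) q
      dXZ : Disjoint (steps AX) (steps AZ)
      dXZ v p q = proj₁ (distinct AX) (subst (_∈ steps AX) (first v (AZ⊆Pz q) (AX⊆P p)) p)
      dYZ : Disjoint (steps AY) (steps AZ)
      dYZ v p q = proj₁ (distinct AY) (subst (_∈ steps AY) (first v (AZ⊆Pz q) (there (back⊆ p))) p)
      m≢x : m ≢ proj₁ x
      m≢x m≡x = leaf-notInner (proj₂ x) (subst-end m≡x Pz) P d x≢z x≢y
        where
          d : Disjoint (proj₁ z ∷ steps Pz) (steps P)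
          d v p q = proj₁ (distinct P) (subst (_∈ steps P) (trans (first v p (there q)) m≡x) q)
      m≢y : m ≢ proj₁ y
      m≢y m≡y = leaf-notInner (proj₂ y) (subst-end m≡y Pz) (SimplePath-reverse P) d y≢z (≢-sym x≢y)
        where
          d : Disjoint (proj₁ z ∷ steps Pz) (steps (SimplePath-reverse P))
          d v p q = proj₁ (distinct (SimplePath-reverse P))
                      (subst (_∈ _) (trans (first v p (reverse-∈ P (there q))) m≡y) q)
      m≢z : m ≢ proj₁ z
      m≢z m≡z with leaf∈SimplePath⇒endpoint (proj₂ z) P (subst (_∈ proj₁ x ∷ steps P) m≡z m∈P)
      ... | inj₁ e = x≢z (sym e)
      ... | inj₂ e = y≢z (sym e)

  medianOf : ∀ (x y z : Leaf E) → proj₁ x ≢ proj₁ y → proj₁ x ≢ proj₁ z → proj₁ y ≢ proj₁ z → Median x y z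
  medianOf x y z x≢y x≢z y≢z
    with proj₂ (simplePath (proj₁ x) (proj₁ y)) | proj₂ (simplePath (proj₁ z) (proj₁ x))
  ... | P | Q with firstHit (_∈ proj₁ x ∷ steps P) (λ v → v ∈? proj₁ x ∷ steps P) (proj₁ z) (steps Q)
                     (subst (_∈ proj₁ x ∷ steps P) (sym (ends Q)) (here refl))
  ...   | Q₁ , Q₂ , eqQ , m∈P , first =
    median-fromHit x y z x≢y x≢z y≢z P
      (prefixPath (proj₁ z) Q₁ Q₂ (subst (λ t → Chain (_ ∷ t)) eqQ (chain Q))
                                  (subst (λ t → Distinct (_ ∷ t)) eqQ (distinct Q)))
      m∈P first

  OnTripod : V → List V → List V → List V → V → Set
  OnTripod m xs ys zs v = v ≡ m ⊎ v ∈ xs ⊎ v ∈ ys ⊎ v ∈ zs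

  OnTripod? : ∀ m xs ys zs v → Dec (OnTripod m xs ys zs v)
  OnTripod? m xs ys zs v = (v ≟ᶠ m) ⊎-dec (v ∈? xs) ⊎-dec (v ∈? ys) ⊎-dec (v ∈? zs)

  -- the path W from u first meets the tripod at cv, an inner vertex of the arm A: cv becomes a
  -- second centre, joined to m by the part of A before cv
  attach : ∀ (a b c u : Leaf E) (m : V) {ka kb kc cv kw}
    (A : SimplePath m (proj₁ a) ka) (B : SimplePath m (proj₁ b) kb) (C : SimplePath m (proj₁ c) kc)
    (W : SimplePath (proj₁ u) cv kw) → steps B ≢ [] → steps C ≢ [] →
    Disjoint (steps A) (steps B) → Disjoint (steps A) (steps C) → Disjoint (steps B) (steps C) →
    proj₁ u ≢ proj₁ a → proj₁ a ≢ proj₁ b → cv ∈ steps A →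
    (∀ v → v ∈ proj₁ u ∷ steps W → OnTripod m (steps A) (steps B) (steps C) v → v ≡ cv) → Ptolemy₄ b c a u
  attach a b c u m {cv = cv} A B C W nB nC dAB dAC dBC u≢a a≢b cv∈A first =
    twoCentres-ptolemy b c a u m cv B C front back AU nB nC (SimplePath-nonempty front (≢-sym cv≢m))
      (SimplePath-nonempty back cv≢a) (SimplePath-nonempty AU cv≢u)
      dBC dA′U (λ v p q → dAB v (front⊆ q) p) (λ v p q → dAC v (front⊆ q) p)
      (λ v p q → dAB v (back⊆ q) p) dBU (λ v p q → dAC v (back⊆ q) p) dCU front#back dMU
    where
      open Split (splitAt A (there cv∈A))
      AU : SimplePath cv (proj₁ u) _
      AU = SimplePath-reverse W
      AU⊆W : ∀ {v} → v ∈ steps AU → v ∈ proj₁ u ∷ steps W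
      AU⊆W p = reverse-∈ W (there p)
      m∉A : m ∉ steps A
      m∉A = proj₁ (distinct A)
      cv∉AU : cv ∉ steps AU
      cv∉AU = proj₁ (distinct AU)
      cv≢m : cv ≢ m
      cv≢m cv≡m = m∉A (subst (_∈ steps A) cv≡m cv∈A)
      cv≢u : cv ≢ proj₁ u
      cv≢u cv≡u with leaf∈SimplePath⇒endpoint (proj₂ u) A (there (subst (_∈ steps A) cv≡u cv∈A))
      ... | inj₁ u≡m = cv≢m (trans cv≡u u≡m)
      ... | inj₂ u≡a = u≢a u≡a
      cv≢a : cv ≢ proj₁ a
      cv≢a cv≡a = leaf-notInner (proj₂ a) (subst-end cv≡a W) AB d (≢-sym u≢a) a≢b
        where
          AB : SimplePath (proj₁ a) (proj₁ b) _
          AB = joinArms A B dAB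
          a∉AB : ∀ {v} → v ≡ cv → v ∉ steps AB
          a∉AB v≡cv = subst (_∉ steps AB) (sym (trans v≡cv cv≡a)) (proj₁ (distinct AB))
          d : Disjoint (proj₁ u ∷ steps W) (steps AB)
          d v p q with joinArms-∈ A B dAB q
          ... | inj₁ (here refl) = cv≢m (sym (first v p (inj₁ refl)))
          ... | inj₁ (there v∈A) = a∉AB (first v p (inj₂ (inj₁ v∈A))) q
          ... | inj₂ v∈B = a∉AB (first v p (inj₂ (inj₂ (inj₁ v∈B)))) q
      dA′U : Disjoint (steps back) (steps AU)
      dA′U v p q = cv∉AU (subst (_∈ steps AU) (first v (AU⊆W q) (inj₂ (inj₁ (back⊆ p)))) q)
      dBU : Disjoint (steps B) (steps AU)
      dBU v p q = dAB cv cv∈A (subst (_∈ steps B) (first v (AU⊆W q) (inj₂ (inj₂ (inj₁ p)))) p)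
      dCU : Disjoint (steps C) (steps AU)
      dCU v p q = dAC cv cv∈A (subst (_∈ steps C) (first v (AU⊆W q) (inj₂ (inj₂ (inj₂ p)))) p)
      dMU : Disjoint (m ∷ steps front) (steps AU)
      dMU v (here refl) q = cv≢m (sym (first v (AU⊆W q) (inj₁ refl)))
      dMU v (there p) q = cv∉AU (subst (_∈ steps AU) (first v (AU⊆W q) (inj₂ (inj₁ (front⊆ p)))) q)

  OnTripod-swap₁₂ : ∀ {m xs ys zs v} → OnTripod m xs ys zs v → OnTripod m ys xs zs v
  OnTripod-swap₁₂ (inj₁ e) = inj₁ e
  OnTripod-swap₁₂ (inj₂ (inj₁ p)) = inj₂ (inj₂ (inj₁ p))
  OnTripod-swap₁₂ (inj₂ (inj₂ (inj₁ p))) = inj₂ (inj₁ p)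
  OnTripod-swap₁₂ (inj₂ (inj₂ (inj₂ p))) = inj₂ (inj₂ (inj₂ p))

  OnTripod-rotate : ∀ {m xs ys zs v} → OnTripod m zs xs ys v → OnTripod m xs ys zs v
  OnTripod-rotate (inj₁ e) = inj₁ e
  OnTripod-rotate (inj₂ (inj₁ p)) = inj₂ (inj₂ (inj₂ p))
  OnTripod-rotate (inj₂ (inj₂ (inj₁ p))) = inj₂ (inj₁ p)
  OnTripod-rotate (inj₂ (inj₂ (inj₂ p))) = inj₂ (inj₂ (inj₁ p))

  -- the path from u to the tripod spanned by x, y, z meets it at the centre or on one of the arms
  ptolemy-fromMedian : ∀ (x y z u : Leaf E) → proj₁ x ≢ proj₁ y → proj₁ x ≢ proj₁ z → proj₁ x ≢ proj₁ u →
                       proj₁ y ≢ proj₁ u → proj₁ z ≢ proj₁ u → Median x y z → Ptolemy₄ x y z u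
  ptolemy-fromMedian x y z u x≢y x≢z x≢u y≢u z≢u (median m _ _ _ AX AY AZ nX nY nZ dXY dXZ dYZ)
    with proj₂ (simplePath (proj₁ u) m)
  ... | R with firstHit (OnTripod m (steps AX) (steps AY) (steps AZ)) (OnTripod? m (steps AX) (steps AY) (steps AZ))
                        (proj₁ u) (steps R) (inj₁ (ends R))
  ...   | W₁ , W₂ , refl , cv∈ , first = byMeetingPoint cv∈
    where
      W : SimplePath (proj₁ u) (end (proj₁ u) W₁) _
      W = prefixPath (proj₁ u) W₁ W₂ (chain R) (distinct R)
      byMeetingPoint : OnTripod m (steps AX) (steps AY) (steps AZ) (end (proj₁ u) W₁) → Ptolemy₄ x y z u
      byMeetingPoint (inj₁ cv≡m) =
        star-ptolemy x y z u m AX AY AZ AU nX nY nZ (SimplePath-nonempty AU m≢u)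
          dXY (disjoint AZ (inj₂ ∘ inj₂ ∘ inj₂)) dXZ (disjoint AX (inj₂ ∘ inj₁)) dYZ (disjoint AY (inj₂ ∘ inj₂ ∘ inj₁))
        where
          AU : SimplePath m (proj₁ u) _
          AU = subst-start cv≡m (SimplePath-reverse W)
          disjoint : ∀ {ℓ k} (A : SimplePath m ℓ k) →
                     (∀ {v} → v ∈ steps A → OnTripod m (steps AX) (steps AY) (steps AZ) v) →
                     Disjoint (steps A) (steps AU)
          disjoint A onA v p q =
            proj₁ (distinct A) (subst (_∈ steps A) (trans (first v (reverse-∈ W (there q)) (onA p)) cv≡m) p)
          m≢u : m ≢ proj₁ u
          m≢u m≡u = leaf-notInner (proj₂ u) (subst-end m≡u (SimplePath-reverse AX)) (subst-start m≡u AY) d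
                      (≢-sym x≢u) (≢-sym y≢u)
            where
              d : Disjoint (proj₁ x ∷ steps (SimplePath-reverse AX)) (steps AY)
              d v p q with reverse-∈ AX p
              ... | here refl = proj₁ (distinct AY) q
              ... | there p′ = dXY v p′ q
      byMeetingPoint (inj₂ (inj₁ cv∈X)) =
        Ptolemy₄-swap₁₂ (Ptolemy₄-swap₂₃ (attach x y z u m AX AY AZ W nY nZ dXY dXZ dYZ (≢-sym x≢u) x≢y cv∈X first))
      byMeetingPoint (inj₂ (inj₂ (inj₁ cv∈Y))) =
        Ptolemy₄-swap₂₃ (attach y x z u m AY AX AZ W nX nZ (Disjoint-sym dXY) dYZ dXZ (≢-sym y≢u) (≢-sym x≢y) cv∈Y
                           (λ v p h → first v p (OnTripod-swap₁₂ h)))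
      byMeetingPoint (inj₂ (inj₂ (inj₂ cv∈Z))) =
        attach z x y u m AZ AX AY W nX nY (Disjoint-sym dXZ) (Disjoint-sym dYZ) dXY (≢-sym z≢u) (≢-sym x≢z) cv∈Z
          (λ v p h → first v p (OnTripod-rotate h))

  ptolemy₄ : ∀ x y z u → Ptolemy₄ x y z u
  ptolemy₄ x y z u with proj₁ x ≟ᶠ proj₁ y
  ... | yes e rewrite Leaf-≡ x y e = Ptolemy₄-coincident y z u
  ... | no x≢y with proj₁ x ≟ᶠ proj₁ z
  ...   | yes e rewrite Leaf-≡ x z e = Ptolemy₄-swap₂₃ (Ptolemy₄-coincident z y u)
  ...   | no x≢z with proj₁ x ≟ᶠ proj₁ u
  ...     | yes e rewrite Leaf-≡ x u e = Ptolemy₄-swap₃₄ (Ptolemy₄-swap₂₃ (Ptolemy₄-coincident u y z))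
  ...     | no x≢u with proj₁ y ≟ᶠ proj₁ z
  ...       | yes e rewrite Leaf-≡ y z e = Ptolemy₄-swap₁₂ (Ptolemy₄-swap₂₃ (Ptolemy₄-coincident z x u))
  ...       | no y≢z with proj₁ y ≟ᶠ proj₁ u
  ...         | yes e rewrite Leaf-≡ y u e =
                Ptolemy₄-swap₃₄ (Ptolemy₄-swap₁₂ (Ptolemy₄-swap₂₃ (Ptolemy₄-coincident u x z)))
  ...         | no y≢u with proj₁ z ≟ᶠ proj₁ u
  ...           | yes e rewrite Leaf-≡ z u e = Ptolemy₄-swapPairs (Ptolemy₄-coincident u x y)
  ...           | no z≢u = ptolemy-fromMedian x y z u x≢y x≢z x≢u y≢u z≢u (medianOf x y z x≢y x≢z y≢z)

proposition6p3 : (n : ℕ) (E : Digraph n) → IsNetwork E → Arboreal E →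
    Ptolemaic (SharedAncestryAdj E)
proposition6p3 n E net arb =
  𝒜-connected , λ x y z u xy zu xu yz xz yu → proj₁ (proj₂ (ptolemy₄ x y z u xy zu xz yu xu yz))
  where open Tree net arb
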